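{- For every $n\ge 4$, $$|A^{1324}(n)|=|A^{2314}(n)|=\binom{n}{2}E_{n-2}-E_n,$$ equivalently both equal $n!$ times the coefficient of $x^n$ in $\frac{x^2-2}{2}(\sec x+\tan x)$.
   Context: A permutation $\sigma$ of $\{1,\dots,n\}$ is alternating if $\sigma_1<\sigma_2>\sigma_3<\sigma_4>\cdots$; $A_n$ is the set of such permutations. For a permutation $P\in A_4$ and $n\ge4$, $A^{P}(n)$ is the set of $\sigma\in A_n$ whose prefix $\sigma_1\sigma_2\sigma_3\sigma_4$ is order-isomorphic to $P$ (has its entries in the same relative order as $P$). $E_n$ is the $n$-th Euler number, $\sum_{n\ge0}E_n\frac{x^n}{n!}=\sec x+\tan x$. -}

module Defs where

open import Data.Nat using (ℕ; zero; suc; _+_; _*_; _∸_; _<_; _≤_)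
open import Data.Nat.Combinatorics using (_C_)
open import Data.Nat.DivMod using (_/_)
open import Data.List using (List; []; _∷_; length; upTo; map; _++_)
open import Data.Nat.ListAction using (sum)
open import Data.List.Relation.Binary.Permutation.Propositional using (_↭_)
open import Data.List.Relation.Unary.Unique.Propositional using (Unique)
open import Data.List.Membership.Propositional using (_∈_)
open import Data.Fin using (Fin)
open import Data.Product using (Σ; _×_; ∃)
open import Function.Bundles using (_⇔_)
open import Relation.Binary.PropositionalEquality using (_≡_)

-- Safe list index (0-based) returning 0 when out of range.
at : List ℕ → ℕ → ℕ
at []       _       = 0
at (x ∷ _)  zero    = x
at (_ ∷ xs) (suc i) = at xs i

-- A permutation of {1,…,n} in one-line notation σ₁σ₂…σₙ, as a list.
IsPerm : ℕ → List ℕ → Set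
IsPerm n σ = σ ↭ upTo' n
  where
  upTo' : ℕ → List ℕ
  upTo' m = map suc (upTo m)

-- Alternating (up-down): σ₁ < σ₂ > σ₃ < σ₄ > ⋯
-- i.e. for 0-based positions i with i+1 < length: σ_i < σ_{i+1} if i even,
-- σ_i > σ_{i+1} if i odd.
data Even : ℕ → Set where
  ev0 : Even 0
  ev2 : ∀ {k} → Even k → Even (suc (suc k))

Alternating : List ℕ → Set
Alternating σ = ∀ (i : ℕ) → suc i < length σ →
  (Even i → at σ i < at σ (suc i)) × ((Even i → Data.Empty.⊥) → at σ (suc i) < at σ i)
  where import Data.Empty

InA : ℕ → List ℕ → Set
InA n σ = IsPerm n σ × Alternating σ

OrderIso4 : List ℕ → List ℕ → Set
OrderIso4 σ P = ∀ (i j : ℕ) → i < 4 → j < 4 → (at σ i < at σ j ⇔ at P i < at P j)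

InAP : List ℕ → ℕ → List ℕ → Set
InAP P n σ = InA n σ × OrderIso4 σ P

HasCard : (List ℕ → Set) → ℕ → Set
HasCard S k = Σ (List (List ℕ)) λ L →
  Unique L × (∀ σ → (σ ∈ L ⇔ S σ)) × (length L ≡ k)

-- Euler numbers via the recurrence obtained from (sec x + tan x)' :
--   E₀ = E₁ = 1,  2 E_{m+1} = Σ_{k=0}^{m} C(m,k) E_k E_{m-k}  (m ≥ 1).
-- eulerList m = [E₀, …, E_m]
private
  step : List ℕ → ℕ → ℕ      -- given [E₀,…,E_m], returns E_{m+1}
  step es zero    = 1
  step es (suc m) = sum (map (λ k → (suc m C k) * at es k * at es (suc m ∸ k)) (upTo (suc (suc m)))) / 2

eulerList : ℕ → List ℕ
eulerList zero    = 1 ∷ []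
eulerList (suc m) = eulerList m ++ (step (eulerList m) m ∷ [])

E : ℕ → ℕ
E n = at (eulerList n) n

{-
Write shape σ for the up-down word of σ (true for an ascent) and β s for the number of permutations of
shape s. Swapping σ₂ and σ₃ (for 1324), resp. rotating σ₁σ₂σ₃ (for 2314), maps A^P(n) bijectively onto
the permutations of shape UUU DUDU…, since the pattern condition with the alternation of σ says exactly
that the rearranged permutation increases on its first four entries and alternates afterwards.

Recording where the maximum sits gives a recursion for β, and from it the shuffle identity
  β (s₁ U s₂) + β (s₁ D s₂) = C(|s₁| + |s₂| + 2, |s₁| + 1) · β s₁ · β s₂.
Together with the complement symmetry β (s̄) = β s, obtained from the same identity by induction on the
number of descents, it yields 2E_{m+2} = E_{m+1} + Σ_j C(m+1, j+1) E_{j+1} E_{m-j} for the counts of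
alternating permutations, so these are the Euler numbers. Finally, for s₁ = U and s₂ = UDUD… of length n−3
the shuffle identity reads β (UUU DUDU…) + E_n = C(n, 2) E_{n−2}.
-}
module Submission where

open import Defs
open import Level using (0ℓ)
open import Data.Bool using (Bool; true; false; not; T; if_then_else_)
open import Data.Empty using (⊥; ⊥-elim)
open import Data.Unit using (⊤; tt)
open import Data.Nat using (ℕ; zero; suc; _+_; _*_; _∸_; _<_; _≤_; _<ᵇ_; s≤s; z≤n; s<s; z<s)
open import Data.Nat.Properties
open import Algebra.Properties.CommutativeSemigroup +-commutativeSemigroup
  using () renaming (interchange to +-interchange; x∙yz≈y∙xz to +-left-commute)
open import Data.Nat.Combinatorics using (_C_; nCn≡1; nCk+nC[k+1]≡[n+1]C[k+1])
open import Data.Nat.DivMod using (_/_; m*n/n≡m)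
open import Data.Nat.GeneralisedArithmetic using (iterate)
open import Data.Nat.ListAction using (sum)
open import Data.Nat.ListAction.Properties using (sum-++)
open import Data.List using (List; []; _∷_; length; map; _++_; upTo; replicate)
open import Data.List.Properties
  using ( length-++; length-map; length-upTo; length-replicate; map-replicate; map-++; map-∘; map-id; upTo-∷ʳ
        ; ++-identityʳ; ∷-injectiveˡ; ∷-injectiveʳ)
open import Data.List.Membership.Propositional using (_∈_; _∉_)
open import Data.List.Membership.Propositional.Properties
  using (∈-++⁺ˡ; ∈-++⁺ʳ; ∈-++⁻; ∈-map⁺; ∈-map⁻; ∈-∃++; ∈-upTo⁺; ∈-upTo⁻)
open import Data.List.Relation.Unary.All as All using (All; []; _∷_)
open import Data.List.Relation.Unary.AllPairs using ([]; _∷_)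
open import Data.List.Relation.Unary.Any using (here; there)
open import Data.List.Relation.Unary.Unique.Propositional using (Unique)
import Data.List.Relation.Unary.Unique.Propositional.Properties as Unique
open import Data.List.Relation.Binary.Permutation.Propositional
  using (_↭_; prep; swap; ↭-sym; ↭-trans; ↭-refl; ↭⇒↭ₛ′; module PermutationReasoning)
open import Data.List.Relation.Binary.Permutation.Propositional.Properties
  using (↭-length; ∈-resp-↭; drop-mid; ↭-singleton-inv; ∷↭∷ʳ) renaming (++-identityʳ to ↭-++-identityʳ)
import Data.List.Relation.Binary.Permutation.Setoid.Properties as ↭ₛ
open import Data.Product using (Σ; ∃; _×_; _,_; proj₁; proj₂)
open import Data.Sum using (_⊎_; inj₁; inj₂)
open import Function using (_∘_)
open import Function.Bundles using (_⇔_; mk⇔; Equivalence)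
open import Function.Construct.Composition using (_⇔-∘_)
open import Relation.Binary.PropositionalEquality
  using (_≡_; _≢_; refl; sym; trans; cong; cong₂; subst; setoid; isEquivalence; module ≡-Reasoning)
open import Relation.Binary.Definitions using (tri<; tri≈; tri>)
open import Relation.Unary using (Pred; _≐_; _∪_; _∩_; Empty; ｛_｝)
open import Relation.Unary.Properties using (≐-sym)

open Equivalence using (to; from)

private variable
  X : Set
  i j k m n p q r N : ℕ
  σ σ′ τ τ′ P : List ℕ
  s t : List Bool
  S S′ : Pred (List ℕ) 0ℓ
  f g : List ℕ → List ℕ

-- Cardinalities

HasCard-cong : S ≐ S′ → HasCard S k → HasCard S′ k
HasCard-cong (S⊆S′ , S′⊆S) (L , !L , ∈L⇔S , |L|) = L , !L , (λ σ → mk⇔ S⊆S′ S′⊆S ⇔-∘ ∈L⇔S σ) , |L|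

HasCard-∅ : Empty S → HasCard S 0
HasCard-∅ ∅S = [] , [] , (λ σ → mk⇔ (λ ()) (⊥-elim ∘ ∅S σ)) , refl

HasCard-｛｝ : ∀ σ → HasCard ｛ σ ｝ 1
HasCard-｛｝ σ = σ ∷ [] , [] ∷ [] , (λ τ → mk⇔ (λ { (here refl) → refl }) (λ { refl → here refl })) , refl

HasCard-∪ : HasCard S m → HasCard S′ n → Empty (S ∩ S′) → HasCard (S ∪ S′) (m + n)
HasCard-∪ {S = S} {S′ = S′} (L , !L , ∈L , |L|) (K , !K , ∈K , |K|) disjoint =
  L ++ K , Unique.++⁺ !L !K (λ (σ∈L , σ∈K) → disjoint _ (to (∈L _) σ∈L , to (∈K _) σ∈K)) ,
  (λ σ → mk⇔ (split σ) (join σ)) , trans (length-++ L) (cong₂ _+_ |L| |K|)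
  where
  split : ∀ σ → σ ∈ L ++ K → (S ∪ S′) σ
  split σ σ∈L++K with ∈-++⁻ L σ∈L++K
  ... | inj₁ σ∈L = inj₁ (to (∈L σ) σ∈L)
  ... | inj₂ σ∈K = inj₂ (to (∈K σ) σ∈K)
  join : ∀ σ → (S ∪ S′) σ → σ ∈ L ++ K
  join σ (inj₁ Sσ) = ∈-++⁺ˡ (from (∈L σ) Sσ)
  join σ (inj₂ S′σ) = ∈-++⁺ʳ L (from (∈K σ) S′σ)

Image : (List ℕ → List ℕ) → Pred (List ℕ) 0ℓ → Pred (List ℕ) 0ℓ
Image f S τ = ∃ λ σ → S σ × τ ≡ f σ

InjectiveOn : Pred (List ℕ) 0ℓ → (List ℕ → List ℕ) → Set
InjectiveOn S f = ∀ {σ σ′} → S σ → S σ′ → f σ ≡ f σ′ → σ ≡ σ′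

Unique-map⁺ : InjectiveOn S f → ∀ {L} → All S L → Unique L → Unique (map f L)
Unique-map⁺ f-inj []         []          = []
Unique-map⁺ {S = S} {f = f} f-inj (Sσ ∷ SL) (σ∉L ∷ !L) = distinct SL σ∉L ∷ Unique-map⁺ f-inj SL !L
  where
  distinct : ∀ {K} → All S K → All (_ ≢_) K → All (f _ ≢_) (map f K)
  distinct []         []          = []
  distinct (Sτ ∷ SK) (σ≢τ ∷ σ≢K) = (σ≢τ ∘ f-inj Sσ Sτ) ∷ distinct SK σ≢K

HasCard-image : InjectiveOn S f → HasCard S k → HasCard (Image f S) k
HasCard-image {S = S} {f = f} f-inj (L , !L , ∈L , |L|) =
  map f L , Unique-map⁺ f-inj (All.tabulate (to (∈L _))) !L ,
  (λ τ → mk⇔ (image τ) (preimage τ)) , trans (length-map f L) |L|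
  where
  image : ∀ τ → τ ∈ map f L → Image f S τ
  image τ τ∈fL with ∈-map⁻ f τ∈fL
  ... | σ , σ∈L , refl = σ , to (∈L σ) σ∈L , refl
  preimage : ∀ τ → Image f S τ → τ ∈ map f L
  preimage τ (σ , Sσ , refl) = ∈-map⁺ f (from (∈L σ) Sσ)

HasCard-bijection : (∀ {σ} → S σ → S′ (f σ)) → (∀ {τ} → S′ τ → S (g τ)) →
  (∀ {τ} → S′ τ → f (g τ) ≡ τ) → (∀ {σ} → S σ → g (f σ) ≡ σ) → HasCard S k → HasCard S′ k
HasCard-bijection {f = f} {g = g} S→S′ S′→S fg gf =
  HasCard-cong ((λ { (σ , Sσ , refl) → S→S′ Sσ }) , (λ S′τ → _ , S′→S S′τ , sym (fg S′τ)))
  ∘ HasCard-image (λ Sσ Sσ′ eq → trans (sym (gf Sσ)) (trans (cong g eq) (gf Sσ′)))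

HasCard-⋃ : (I : List X) (Q : X → Pred (List ℕ) 0ℓ) (c : X → ℕ) → Unique I →
  (∀ {i} → i ∈ I → HasCard (Q i) (c i)) → (∀ {i j σ} → i ∈ I → j ∈ I → Q i σ → Q j σ → i ≡ j) →
  HasCard (λ σ → ∃ λ i → i ∈ I × Q i σ) (sum (map c I))
HasCard-⋃ [] Q c [] _ _ = HasCard-∅ λ { σ (i , () , _) }
HasCard-⋃ (i ∷ I) Q c (i∉I ∷ !I) #Q Q-disjoint =
  HasCard-cong (join , split)
    (HasCard-∪ (#Q (here refl)) (HasCard-⋃ I Q c !I (#Q ∘ there) λ i∈ j∈ → Q-disjoint (there i∈) (there j∈))
      λ { σ (Qiσ , j , j∈I , Qjσ) → All.lookup i∉I j∈I (Q-disjoint (here refl) (there j∈I) Qiσ Qjσ) })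
  where
  join : ∀ {σ} → Q i σ ⊎ (∃ λ j → j ∈ I × Q j σ) → ∃ λ j → j ∈ i ∷ I × Q j σ
  join (inj₁ Qiσ)              = i , here refl , Qiσ
  join (inj₂ (j , j∈I , Qjσ)) = j , there j∈I , Qjσ
  split : ∀ {σ} → (∃ λ j → j ∈ i ∷ I × Q j σ) → Q i σ ⊎ (∃ λ j → j ∈ I × Q j σ)
  split (j , here refl , Qjσ)  = inj₁ Qjσ
  split (j , there j∈I , Qjσ) = inj₂ (j , j∈I , Qjσ)

-- Finite sums

sumTo : ℕ → (ℕ → ℕ) → ℕ
sumTo zero    h = 0
sumTo (suc n) h = sumTo n h + h n

sum-map-upTo : ∀ n (h : ℕ → ℕ) → sum (map h (upTo n)) ≡ sumTo n h
sum-map-upTo zero    h = refl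
sum-map-upTo (suc n) h = begin
  sum (map h (upTo (suc n)))          ≡⟨ cong (sum ∘ map h) (upTo-∷ʳ n) ⟨
  sum (map h (upTo n ++ n ∷ []))      ≡⟨ cong sum (map-++ h (upTo n) (n ∷ [])) ⟩
  sum (map h (upTo n) ++ h n ∷ [])    ≡⟨ sum-++ (map h (upTo n)) (h n ∷ []) ⟩
  sum (map h (upTo n)) + (h n + 0)    ≡⟨ cong₂ _+_ (sum-map-upTo n h) (+-identityʳ (h n)) ⟩
  sumTo n h + h n                     ∎
  where open ≡-Reasoning

sumTo-cong : ∀ n {h h′ : ℕ → ℕ} → (∀ {p} → p < n → h p ≡ h′ p) → sumTo n h ≡ sumTo n h′
sumTo-cong zero    eq = refl
sumTo-cong (suc n) eq = cong₂ _+_ (sumTo-cong n (eq ∘ m≤n⇒m≤1+n)) (eq ≤-refl)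

sumTo-+ : ∀ n (h h′ : ℕ → ℕ) → sumTo n (λ p → h p + h′ p) ≡ sumTo n h + sumTo n h′
sumTo-+ zero    h h′ = refl
sumTo-+ (suc n) h h′ = trans (cong (_+ (h n + h′ n)) (sumTo-+ n h h′)) (+-interchange (sumTo n h) (sumTo n h′) (h n) (h′ n))

sumTo-*ˡ : ∀ n m (h : ℕ → ℕ) → sumTo n (λ p → m * h p) ≡ m * sumTo n h
sumTo-*ˡ zero    m h = sym (*-zeroʳ m)
sumTo-*ˡ (suc n) m h = trans (cong (_+ m * h n) (sumTo-*ˡ n m h)) (sym (*-distribˡ-+ m (sumTo n h) (h n)))

sumTo-*ʳ : ∀ n m (h : ℕ → ℕ) → sumTo n (λ p → h p * m) ≡ sumTo n h * m
sumTo-*ʳ n m h = trans (sumTo-cong n (λ {p} _ → *-comm (h p) m)) (trans (sumTo-*ˡ n m h) (*-comm m _))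

sumTo-split : ∀ m n (h : ℕ → ℕ) → sumTo (m + n) h ≡ sumTo m h + sumTo n (h ∘ (m +_))
sumTo-split m zero    h = trans (cong (λ z → sumTo z h) (+-identityʳ m)) (sym (+-identityʳ _))
sumTo-split m (suc n) h = begin
  sumTo (m + suc n) h                                    ≡⟨ cong (λ z → sumTo z h) (+-suc m n) ⟩
  sumTo (m + n) h + h (m + n)                            ≡⟨ cong (_+ h (m + n)) (sumTo-split m n h) ⟩
  sumTo m h + sumTo n (h ∘ (m +_)) + h (m + n)           ≡⟨ +-assoc (sumTo m h) _ _ ⟩
  sumTo m h + sumTo (suc n) (h ∘ (m +_))                 ∎
  where open ≡-Reasoning

sum-map-cong : ∀ (L : List X) {h h′ : X → ℕ} → (∀ {x} → x ∈ L → h x ≡ h′ x) → sum (map h L) ≡ sum (map h′ L)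
sum-map-cong []      eq = refl
sum-map-cong (x ∷ L) eq = cong₂ _+_ (eq (here refl)) (sum-map-cong L (eq ∘ there))

sum-map-+ : ∀ (L : List X) (h h′ : X → ℕ) → sum (map (λ x → h x + h′ x) L) ≡ sum (map h L) + sum (map h′ L)
sum-map-+ []      h h′ = refl
sum-map-+ (x ∷ L) h h′ = trans (cong (h x + h′ x +_) (sum-map-+ L h h′)) (+-interchange (h x) (h′ x) _ _)

sum-map-*ˡ : ∀ (L : List X) m (h : X → ℕ) → sum (map (λ x → m * h x) L) ≡ m * sum (map h L)
sum-map-*ˡ []      m h = sym (*-zeroʳ m)
sum-map-*ˡ (x ∷ L) m h = trans (cong (m * h x +_) (sum-map-*ˡ L m h)) (sym (*-distribˡ-+ m (h x) _))

sum-map-*ʳ : ∀ (L : List X) m (h : X → ℕ) → sum (map (λ x → h x * m) L) ≡ sum (map h L) * m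
sum-map-*ʳ L m h = trans (sum-map-cong L (λ {x} _ → *-comm (h x) m)) (trans (sum-map-*ˡ L m h) (*-comm m _))

sum-map-∘ : ∀ {Y : Set} (L : List X) (h : Y → ℕ) (u : X → Y) → sum (map h (map u L)) ≡ sum (map (h ∘ u) L)
sum-map-∘ L h u = cong sum (sym (map-∘ L))

HasCard-⋃< : (Q : ℕ → Pred (List ℕ) 0ℓ) (c : ℕ → ℕ) →
  (∀ {p} → p < N → HasCard (Q p) (c p)) → (∀ {p q σ} → p < N → q < N → Q p σ → Q q σ → p ≡ q) →
  HasCard (λ σ → ∃ λ p → p < N × Q p σ) (sumTo N c)
HasCard-⋃< {N = N} Q c #Q Q-disjoint =
  subst (HasCard _) (sum-map-upTo N c)
    (HasCard-cong ((λ (p , p∈ , Qpσ) → p , ∈-upTo⁻ p∈ , Qpσ) , (λ (p , p< , Qpσ) → p , ∈-upTo⁺ p< , Qpσ))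
      (HasCard-⋃ (upTo N) Q c (Unique.upTo⁺ N) (#Q ∘ ∈-upTo⁻) λ p∈ q∈ → Q-disjoint (∈-upTo⁻ p∈) (∈-upTo⁻ q∈)))

-- Permutations by shape

oneTo : ℕ → List ℕ
oneTo n = map suc (upTo n)

oneTo-suc : ∀ n → oneTo (suc n) ≡ oneTo n ++ suc n ∷ []
oneTo-suc n = trans (cong (map suc) (sym (upTo-∷ʳ n))) (map-++ suc (upTo n) (n ∷ []))

IsPerm⇒length : IsPerm n σ → length σ ≡ n
IsPerm⇒length {n} σ↭ = trans (↭-length σ↭) (trans (length-map suc (upTo n)) (length-upTo n))

IsPerm⇒All< : IsPerm n σ → All (_< suc n) σ
IsPerm⇒All< σ↭ = All.tabulate λ x∈σ → bound (∈-map⁻ suc (∈-resp-↭ σ↭ x∈σ))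
  where
  bound : ∀ {n x} → ∃ (λ y → y ∈ upTo n × x ≡ suc y) → x < suc n
  bound (y , y∈ , refl) = s≤s (∈-upTo⁻ y∈)

IsPerm⇒∉ : IsPerm n σ → suc n ∉ σ
IsPerm⇒∉ σ↭ n+1∈σ = <-irrefl refl (All.lookup (IsPerm⇒All< σ↭) n+1∈σ)

IsPerm⇒Unique : IsPerm n σ → Unique σ
IsPerm⇒Unique {n} σ↭ =
  ↭ₛ.Unique-resp-↭ (setoid ℕ) (↭⇒↭ₛ′ isEquivalence (↭-sym σ↭)) (Unique.map⁺ suc-injective (Unique.upTo⁺ n))

<ᵇ-true : m < n → (m <ᵇ n) ≡ true
<ᵇ-true {m} {n} m<n with m <ᵇ n in eq
... | true  = refl
... | false = ⊥-elim (subst T eq (<⇒<ᵇ m<n))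

<ᵇ-true⁻¹ : (m <ᵇ n) ≡ true → m < n
<ᵇ-true⁻¹ {m} {n} m<ᵇn = <ᵇ⇒< m n (subst T (sym m<ᵇn) tt)

<ᵇ-false : n < m → (m <ᵇ n) ≡ false
<ᵇ-false {n} {m} n<m with m <ᵇ n in eq
... | false = refl
... | true  = ⊥-elim (<-asym n<m (<ᵇ-true⁻¹ eq))

shape : List ℕ → List Bool
shape (x ∷ y ∷ σ) = (x <ᵇ y) ∷ shape (y ∷ σ)
shape _           = []

insertAt : ℕ → ℕ → List ℕ → List ℕ
insertAt zero    m σ       = m ∷ σ
insertAt (suc p) m []      = m ∷ []
insertAt (suc p) m (x ∷ σ) = x ∷ insertAt p m σ

insertAt-++ : ∀ m α β → insertAt (length α) m (α ++ β) ≡ α ++ m ∷ β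
insertAt-++ m []      β = refl
insertAt-++ m (x ∷ α) β = cong (x ∷_) (insertAt-++ m α β)

insertAt-↭ : ∀ p m σ → insertAt p m σ ↭ m ∷ σ
insertAt-↭ zero    m σ       = ↭-refl
insertAt-↭ (suc p) m []      = ↭-refl
insertAt-↭ (suc p) m (x ∷ σ) = ↭-trans (prep x (insertAt-↭ p m σ)) (swap x m ↭-refl)

insertAt-injective : m ∉ σ → m ∉ σ′ → p ≤ length σ → q ≤ length σ′ →
  insertAt p m σ ≡ insertAt q m σ′ → p ≡ q × σ ≡ σ′
insertAt-injective {p = zero}  {q = zero}  _ _ _ _ eq = refl , ∷-injectiveʳ eq
insertAt-injective {σ′ = _ ∷ _} {p = zero} {q = suc q} _ m∉σ′ _ _ eq = ⊥-elim (m∉σ′ (here (∷-injectiveˡ eq)))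
insertAt-injective {σ = _ ∷ _} {p = suc p} {q = zero} m∉σ _ _ _ eq = ⊥-elim (m∉σ (here (sym (∷-injectiveˡ eq))))
insertAt-injective {σ = x ∷ σ} {σ′ = x′ ∷ σ′} {p = suc p} {q = suc q} m∉σ m∉σ′ (s≤s p≤) (s≤s q≤) eq
  with refl ← ∷-injectiveˡ eq
  with refl , refl ← insertAt-injective (m∉σ ∘ there) (m∉σ′ ∘ there) p≤ q≤ (∷-injectiveʳ eq)
  = refl , refl

-- Meaningful for shapes of nonempty permutations and p ≤ their length; junk otherwise.
insertMaxShape : ℕ → List Bool → List Bool
insertMaxShape zero          s       = false ∷ s
insertMaxShape (suc zero)    []      = true ∷ []
insertMaxShape (suc zero)    (_ ∷ s) = true ∷ false ∷ s
insertMaxShape (suc (suc p)) []      = []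
insertMaxShape (suc (suc p)) (b ∷ s) = b ∷ insertMaxShape (suc p) s

shape-insertAt : 0 < length σ → p ≤ length σ → All (_< m) σ → shape (insertAt p m σ) ≡ insertMaxShape p (shape σ)
shape-insertAt {y ∷ σ}     {zero}          _ _ (y<m ∷ _)        = cong (_∷ shape (y ∷ σ)) (<ᵇ-false y<m)
shape-insertAt {x ∷ []}    {suc zero}      _ _ (x<m ∷ _)        = cong (_∷ []) (<ᵇ-true x<m)
shape-insertAt {x ∷ y ∷ σ} {suc zero}      _ _ (x<m ∷ y<m ∷ _)  =
  cong₂ _∷_ (<ᵇ-true x<m) (cong (_∷ shape (y ∷ σ)) (<ᵇ-false y<m))
shape-insertAt {x ∷ y ∷ σ} {suc (suc p)}   _ (s≤s p≤) (_ ∷ σ<m) = cong ((x <ᵇ y) ∷_) (shape-insertAt (s≤s z≤n) p≤ σ<m)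
shape-insertAt {x ∷ []}    {suc (suc p)}   _ (s≤s ()) _

insertMaxShape⁻¹ : ℕ → List Bool → List (List Bool)
insertMaxShape⁻¹ zero          (false ∷ s)         = s ∷ []
insertMaxShape⁻¹ zero          _                   = []
insertMaxShape⁻¹ (suc zero)    (true ∷ [])         = [] ∷ []
insertMaxShape⁻¹ (suc zero)    (true ∷ false ∷ s)  = (true ∷ s) ∷ (false ∷ s) ∷ []
insertMaxShape⁻¹ (suc zero)    _                   = []
insertMaxShape⁻¹ (suc (suc p)) []                  = [] ∷ []
insertMaxShape⁻¹ (suc (suc p)) (b ∷ s)             = map (b ∷_) (insertMaxShape⁻¹ (suc p) s)

insertMaxShape⁻¹-sound : ∀ p s → t ∈ insertMaxShape⁻¹ p s → insertMaxShape p t ≡ s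
insertMaxShape⁻¹-sound zero          (false ∷ s)        (here refl)         = refl
insertMaxShape⁻¹-sound (suc zero)    (true ∷ [])        (here refl)         = refl
insertMaxShape⁻¹-sound (suc zero)    (true ∷ false ∷ s) (here refl)         = refl
insertMaxShape⁻¹-sound (suc zero)    (true ∷ false ∷ s) (there (here refl)) = refl
insertMaxShape⁻¹-sound (suc (suc p)) []                 (here refl)         = refl
insertMaxShape⁻¹-sound (suc (suc p)) (b ∷ s)            t∈
  with t′ , t′∈ , refl ← ∈-map⁻ (b ∷_) t∈ = cong (b ∷_) (insertMaxShape⁻¹-sound (suc p) s t′∈)

insertMaxShape⁻¹-complete : ∀ p t → t ∈ insertMaxShape⁻¹ p (insertMaxShape p t)
insertMaxShape⁻¹-complete zero          t           = here refl
insertMaxShape⁻¹-complete (suc zero)    []          = here refl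
insertMaxShape⁻¹-complete (suc zero)    (true ∷ t)  = here refl
insertMaxShape⁻¹-complete (suc zero)    (false ∷ t) = there (here refl)
insertMaxShape⁻¹-complete (suc (suc p)) []          = here refl
insertMaxShape⁻¹-complete (suc (suc p)) (b ∷ t)     = ∈-map⁺ (b ∷_) (insertMaxShape⁻¹-complete (suc p) t)

insertMaxShape⁻¹-unique : ∀ p s → Unique (insertMaxShape⁻¹ p s)
insertMaxShape⁻¹-unique zero          (false ∷ s)        = [] ∷ []
insertMaxShape⁻¹-unique zero          []                 = []
insertMaxShape⁻¹-unique zero          (true ∷ s)         = []
insertMaxShape⁻¹-unique (suc zero)    []                 = []
insertMaxShape⁻¹-unique (suc zero)    (false ∷ s)        = []
insertMaxShape⁻¹-unique (suc zero)    (true ∷ [])        = [] ∷ []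
insertMaxShape⁻¹-unique (suc zero)    (true ∷ true ∷ s)  = []
insertMaxShape⁻¹-unique (suc zero)    (true ∷ false ∷ s) = ((λ ()) ∷ []) ∷ [] ∷ []
insertMaxShape⁻¹-unique (suc (suc p)) []                 = [] ∷ []
insertMaxShape⁻¹-unique (suc (suc p)) (b ∷ s)            = Unique.map⁺ ∷-injectiveʳ (insertMaxShape⁻¹-unique (suc p) s)

length-insertMaxShape⁻¹ : ∀ p s → p ≤ length s → t ∈ insertMaxShape⁻¹ p s → suc (length t) ≡ length s
length-insertMaxShape⁻¹ zero          (false ∷ s)        _        (here refl)         = refl
length-insertMaxShape⁻¹ (suc zero)    (true ∷ [])        _        (here refl)         = refl
length-insertMaxShape⁻¹ (suc zero)    (true ∷ false ∷ s) _        (here refl)         = refl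
length-insertMaxShape⁻¹ (suc zero)    (true ∷ false ∷ s) _        (there (here refl)) = refl
length-insertMaxShape⁻¹ (suc (suc p)) (b ∷ s)            (s≤s p≤) t∈
  with t′ , t′∈ , refl ← ∈-map⁻ (b ∷_) t∈ = cong suc (length-insertMaxShape⁻¹ (suc p) s p≤ t′∈)

Perms : ℕ → List Bool → Pred (List ℕ) 0ℓ
Perms n s σ = IsPerm n σ × shape σ ≡ s

IsPerm-insertMax : ∀ p → IsPerm n σ → IsPerm (suc n) (insertAt p (suc n) σ)
IsPerm-insertMax {n} {σ} p σ↭ = begin
  insertAt p (suc n) σ      ↭⟨ insertAt-↭ p (suc n) σ ⟩
  suc n ∷ σ                 ↭⟨ prep (suc n) σ↭ ⟩
  suc n ∷ oneTo n           ↭⟨ ∷↭∷ʳ (suc n) (oneTo n) ⟩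
  oneTo n ++ suc n ∷ []     ≡⟨ oneTo-suc n ⟨
  oneTo (suc n)             ∎
  where open PermutationReasoning

IsPerm-removeMax : IsPerm (suc n) σ → ∃ λ p → ∃ λ τ → p ≤ n × IsPerm n τ × σ ≡ insertAt p (suc n) τ
IsPerm-removeMax {n} {σ} σ↭
  with α , β , refl ← ∈-∃++ (∈-resp-↭ (↭-sym (subst (σ ↭_) (oneTo-suc n) σ↭)) (∈-++⁺ʳ (oneTo n) (here refl)))
  = length α , α ++ β , p≤n , τ↭ , sym (insertAt-++ (suc n) α β)
  where
  τ↭ : α ++ β ↭ oneTo n
  τ↭ = ↭-trans (drop-mid α (oneTo n) (subst (α ++ suc n ∷ β ↭_) (oneTo-suc n) σ↭)) (↭-++-identityʳ (oneTo n))
  p≤n : length α ≤ n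
  p≤n = subst (length α ≤_) (trans (sym (length-++ α)) (IsPerm⇒length τ↭)) (m≤m+n (length α) (length β))

shape-insertMax : p ≤ suc n → IsPerm (suc n) τ → shape (insertAt p (suc (suc n)) τ) ≡ insertMaxShape p (shape τ)
shape-insertMax {p} {n} p≤ τ↭ =
  shape-insertAt (subst (0 <_) (sym (IsPerm⇒length τ↭)) (s≤s z≤n)) (subst (p ≤_) (sym (IsPerm⇒length τ↭)) p≤) (IsPerm⇒All< τ↭)

insertMax-injective : IsPerm n τ → IsPerm n τ′ → p ≤ n → q ≤ n →
  insertAt p (suc n) τ ≡ insertAt q (suc n) τ′ → p ≡ q × τ ≡ τ′
insertMax-injective {p = p} {q = q} τ↭ τ′↭ p≤ q≤ =
  insertAt-injective (IsPerm⇒∉ τ↭) (IsPerm⇒∉ τ′↭)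
    (subst (p ≤_) (sym (IsPerm⇒length τ↭)) p≤) (subst (q ≤_) (sym (IsPerm⇒length τ′↭)) q≤)

MaxInsertedAt : ℕ → List Bool → ℕ → Pred (List ℕ) 0ℓ
MaxInsertedAt n s p σ = ∃ λ t → t ∈ insertMaxShape⁻¹ p s × Image (insertAt p (suc (suc n))) (Perms (suc n) t) σ

Perms-decompose : Perms (suc (suc n)) s ≐ λ σ → ∃ λ p → p < suc (suc n) × MaxInsertedAt n s p σ
Perms-decompose {n} {s} = removeMax , insertMax
  where
  removeMax : ∀ {σ} → Perms (suc (suc n)) s σ → ∃ λ p → p < suc (suc n) × MaxInsertedAt n s p σ
  removeMax (σ↭ , refl) with p , τ , p≤ , τ↭ , refl ← IsPerm-removeMax σ↭ =
    p , s≤s p≤ , shape τ ,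
    subst (λ s → shape τ ∈ insertMaxShape⁻¹ p s) (sym (shape-insertMax p≤ τ↭)) (insertMaxShape⁻¹-complete p (shape τ)) ,
    τ , (τ↭ , refl) , refl
  insertMax : ∀ {σ} → (∃ λ p → p < suc (suc n) × MaxInsertedAt n s p σ) → Perms (suc (suc n)) s σ
  insertMax (p , s≤s p≤ , t , t∈ , τ , (τ↭ , refl) , refl) =
    IsPerm-insertMax p τ↭ , trans (shape-insertMax p≤ τ↭) (insertMaxShape⁻¹-sound p s t∈)

-- β′ k s recurses on the position of the maximum; the fuel k = length s makes the recursion structural.
β′ : ℕ → List Bool → ℕ
β′ zero    s = 1
β′ (suc k) s = sumTo (suc (suc k)) λ p → sum (map (β′ k) (insertMaxShape⁻¹ p s))

β : List Bool → ℕ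
β s = β′ (length s) s

Perms-count′ : ∀ k s → length s ≡ k → HasCard (Perms (suc k) s) (β′ k s)
Perms-count′ zero    [] refl =
  HasCard-cong ((λ { refl → ↭-refl , refl }) , λ (σ↭ , _) → sym (↭-singleton-inv σ↭)) (HasCard-｛｝ (1 ∷ []))
Perms-count′ (suc k) s |s| =
  HasCard-cong (≐-sym Perms-decompose) (HasCard-⋃< (MaxInsertedAt k s) _ #MaxInsertedAt at-same-position)
  where
  #MaxInsertedAt : p < suc (suc k) → HasCard (MaxInsertedAt k s p) (sum (map (β′ k) (insertMaxShape⁻¹ p s)))
  #MaxInsertedAt {p} (s≤s p≤) = HasCard-⋃ (insertMaxShape⁻¹ p s) _ (β′ k) (insertMaxShape⁻¹-unique p s)
    (λ t∈ → HasCard-image injective (Perms-count′ k _ (|t|≡k t∈)))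
    (λ { _ _ (τ , (τ↭ , refl) , refl) (τ′ , (τ′↭ , refl) , eq) →
           cong shape (proj₂ (insertMax-injective τ↭ τ′↭ p≤ p≤ eq)) })
    where
    |t|≡k : t ∈ insertMaxShape⁻¹ p s → length t ≡ k
    |t|≡k t∈ = suc-injective (trans (length-insertMaxShape⁻¹ p s (subst (p ≤_) (sym |s|) p≤) t∈) |s|)
    injective : InjectiveOn (Perms (suc k) t) (insertAt p (suc (suc k)))
    injective (τ↭ , _) (τ′↭ , _) = proj₂ ∘ insertMax-injective τ↭ τ′↭ p≤ p≤
  at-same-position : p < suc (suc k) → q < suc (suc k) → MaxInsertedAt k s p σ → MaxInsertedAt k s q σ → p ≡ q
  at-same-position (s≤s p≤) (s≤s q≤) (_ , _ , τ , (τ↭ , _) , refl) (_ , _ , τ′ , (τ′↭ , _) , eq) =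
    proj₁ (insertMax-injective τ↭ τ′↭ p≤ q≤ eq)

Perms-count : ∀ s → HasCard (Perms (suc (length s)) s) (β s)
Perms-count s = Perms-count′ (length s) s refl

βMaxAt : List Bool → ℕ → ℕ
βMaxAt s p = sum (map β (insertMaxShape⁻¹ p s))

β-unfold : length s ≡ suc k → β s ≡ sumTo (suc (suc k)) (βMaxAt s)
β-unfold {b ∷ s} {k} refl = sumTo-cong (suc (suc k)) λ {p} p< → sum-map-cong (insertMaxShape⁻¹ p (b ∷ s)) λ {t} t∈ →
  cong (λ z → β′ z t) (sym (suc-injective (length-insertMaxShape⁻¹ p (b ∷ s) (≤-pred p<) t∈)))

-- The shuffle identity

insertMaxShape⁻¹-++ˡ : ∀ p s₁ r → p < length s₁ → insertMaxShape⁻¹ p (s₁ ++ r) ≡ map (_++ r) (insertMaxShape⁻¹ p s₁)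
insertMaxShape⁻¹-++ˡ zero          (true ∷ s₁)         r _        = refl
insertMaxShape⁻¹-++ˡ zero          (false ∷ s₁)        r _        = refl
insertMaxShape⁻¹-++ˡ (suc zero)    (false ∷ _ ∷ s₁)    r _        = refl
insertMaxShape⁻¹-++ˡ (suc zero)    (true ∷ true ∷ s₁)  r _        = refl
insertMaxShape⁻¹-++ˡ (suc zero)    (true ∷ false ∷ s₁) r _        = refl
insertMaxShape⁻¹-++ˡ (suc zero)    (b ∷ [])            r (s≤s ())
insertMaxShape⁻¹-++ˡ (suc (suc p)) (b ∷ s₁)            r (s≤s p<) = begin
  map (b ∷_) (insertMaxShape⁻¹ (suc p) (s₁ ++ r))           ≡⟨ cong (map (b ∷_)) (insertMaxShape⁻¹-++ˡ (suc p) s₁ r p<) ⟩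
  map (b ∷_) (map (_++ r) (insertMaxShape⁻¹ (suc p) s₁))    ≡⟨ map-∘ (insertMaxShape⁻¹ (suc p) s₁) ⟨
  map ((b ∷_) ∘ (_++ r)) (insertMaxShape⁻¹ (suc p) s₁)      ≡⟨ map-∘ (insertMaxShape⁻¹ (suc p) s₁) ⟩
  map (_++ r) (map (b ∷_) (insertMaxShape⁻¹ (suc p) s₁))    ∎
  where open ≡-Reasoning

insertMaxShape⁻¹-++ʳ : ∀ s₁ q r → insertMaxShape⁻¹ (suc (length s₁ + q)) (s₁ ++ r) ≡ map (s₁ ++_) (insertMaxShape⁻¹ (suc q) r)
insertMaxShape⁻¹-++ʳ []       q r = sym (map-id (insertMaxShape⁻¹ (suc q) r))
insertMaxShape⁻¹-++ʳ (b ∷ s₁) q r =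
  trans (cong (map (b ∷_)) (insertMaxShape⁻¹-++ʳ s₁ q r)) (sym (map-∘ (insertMaxShape⁻¹ (suc q) r)))

-- A maximum at the end of the first block must be followed by a descent.
insertMaxShape⁻¹-++-ascent : ∀ s₁ s₂ → 0 < length s₁ → insertMaxShape⁻¹ (length s₁) (s₁ ++ true ∷ s₂) ≡ []
insertMaxShape⁻¹-++-ascent (true ∷ [])      s₂ _ = refl
insertMaxShape⁻¹-++-ascent (false ∷ [])     s₂ _ = refl
insertMaxShape⁻¹-++-ascent (b ∷ b′ ∷ s₁)    s₂ _ = cong (map (b ∷_)) (insertMaxShape⁻¹-++-ascent (b′ ∷ s₁) s₂ (s≤s z≤n))

insertMaxShape⁻¹-++-descent : ∀ s₁ s₂ (h : List Bool → ℕ) → 0 < length s₁ →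
  sum (map h (insertMaxShape⁻¹ (length s₁) (s₁ ++ false ∷ s₂)))
    ≡ sum (map (λ t → h (t ++ true ∷ s₂) + h (t ++ false ∷ s₂)) (insertMaxShape⁻¹ (length s₁) s₁))
insertMaxShape⁻¹-++-descent (true ∷ [])   s₂ h _ = sym (+-assoc (h (true ∷ s₂)) (h (false ∷ s₂)) 0)
insertMaxShape⁻¹-++-descent (false ∷ [])  s₂ h _ = refl
insertMaxShape⁻¹-++-descent (b ∷ b′ ∷ s₁) s₂ h _ = begin
  sum (map h (map (b ∷_) (insertMaxShape⁻¹ (suc (length s₁)) (b′ ∷ s₁ ++ false ∷ s₂))))
    ≡⟨ sum-map-∘ (insertMaxShape⁻¹ (suc (length s₁)) (b′ ∷ s₁ ++ false ∷ s₂)) h (b ∷_) ⟩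
  sum (map (h ∘ (b ∷_)) (insertMaxShape⁻¹ (suc (length s₁)) (b′ ∷ s₁ ++ false ∷ s₂)))
    ≡⟨ insertMaxShape⁻¹-++-descent (b′ ∷ s₁) s₂ (h ∘ (b ∷_)) (s≤s z≤n) ⟩
  sum (map ((λ t → h (t ++ true ∷ s₂) + h (t ++ false ∷ s₂)) ∘ (b ∷_)) (insertMaxShape⁻¹ (suc (length s₁)) (b′ ∷ s₁)))
    ≡⟨ sum-map-∘ (insertMaxShape⁻¹ (suc (length s₁)) (b′ ∷ s₁)) _ (b ∷_) ⟨
  sum (map (λ t → h (t ++ true ∷ s₂) + h (t ++ false ∷ s₂)) (map (b ∷_) (insertMaxShape⁻¹ (suc (length s₁)) (b′ ∷ s₁))))
    ∎
  where open ≡-Reasoning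

βJoin : List Bool → List Bool → ℕ
βJoin s₁ s₂ = β (s₁ ++ true ∷ s₂) + β (s₁ ++ false ∷ s₂)

βMaxAtJoin : List Bool → List Bool → ℕ → ℕ
βMaxAtJoin s₁ s₂ p = βMaxAt (s₁ ++ true ∷ s₂) p + βMaxAt (s₁ ++ false ∷ s₂) p

ShuffleIdentity : List Bool → List Bool → Set
ShuffleIdentity s₁ s₂ = βJoin s₁ s₂ ≡ ((suc (length s₁) + suc (length s₂)) C suc (length s₁)) * (β s₁ * β s₂)

βJoin-unfold : ∀ s₁ s₂ → βJoin s₁ s₂ ≡ sumTo (suc (length s₁) + suc (length s₂)) (βMaxAtJoin s₁ s₂)
βJoin-unfold s₁ s₂ = begin
  βJoin s₁ s₂
    ≡⟨ cong₂ _+_ (β-unfold (length-join true)) (β-unfold {k = length s₁ + length s₂} (length-join false)) ⟩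
  sumTo (suc (suc (length s₁ + length s₂))) (βMaxAt (s₁ ++ true ∷ s₂))
    + sumTo (suc (suc (length s₁ + length s₂))) (βMaxAt (s₁ ++ false ∷ s₂))
    ≡⟨ sumTo-+ (suc (suc (length s₁ + length s₂))) _ _ ⟨
  sumTo (suc (suc (length s₁ + length s₂))) (βMaxAtJoin s₁ s₂)
    ≡⟨ cong (λ n → sumTo (suc n) (βMaxAtJoin s₁ s₂)) (+-suc (length s₁) (length s₂)) ⟨
  sumTo (suc (length s₁) + suc (length s₂)) (βMaxAtJoin s₁ s₂)
    ∎
  where
  open ≡-Reasoning
  length-join : ∀ b → length (s₁ ++ b ∷ s₂) ≡ suc (length s₁ + length s₂)
  length-join b = trans (length-++ s₁) (+-suc (length s₁) (length s₂))

βMaxAtJoin-left : ∀ s₁ s₂ → 0 < length s₁ → p < suc (length s₁) →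
  βMaxAtJoin s₁ s₂ p ≡ sum (map (λ t → βJoin t s₂) (insertMaxShape⁻¹ p s₁))
βMaxAtJoin-left {p} s₁ s₂ 0<|s₁| (s≤s p≤) with m≤n⇒m<n∨m≡n p≤
... | inj₁ p<|s₁| = begin
  βMaxAtJoin s₁ s₂ p
    ≡⟨ cong₂ _+_ (left true) (left false) ⟩
  sum (map (β ∘ (_++ true ∷ s₂)) (insertMaxShape⁻¹ p s₁)) + sum (map (β ∘ (_++ false ∷ s₂)) (insertMaxShape⁻¹ p s₁))
    ≡⟨ sum-map-+ (insertMaxShape⁻¹ p s₁) _ _ ⟨
  sum (map (λ t → βJoin t s₂) (insertMaxShape⁻¹ p s₁))
    ∎
  where
  open ≡-Reasoning
  left : ∀ b → βMaxAt (s₁ ++ b ∷ s₂) p ≡ sum (map (β ∘ (_++ b ∷ s₂)) (insertMaxShape⁻¹ p s₁))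
  left b = trans (cong (sum ∘ map β) (insertMaxShape⁻¹-++ˡ p s₁ (b ∷ s₂) p<|s₁|)) (sum-map-∘ (insertMaxShape⁻¹ p s₁) β _)
... | inj₂ refl = cong₂ _+_ (cong (sum ∘ map β) (insertMaxShape⁻¹-++-ascent s₁ s₂ 0<|s₁|))
                            (insertMaxShape⁻¹-++-descent s₁ s₂ β 0<|s₁|)

βMaxAtJoin-right : ∀ s₁ s₂ q → 0 < length s₂ →
  βMaxAtJoin s₁ s₂ (suc (length s₁ + q)) ≡ sum (map (βJoin s₁) (insertMaxShape⁻¹ q s₂))
βMaxAtJoin-right s₁ (b ∷ s₂) zero _ =
  trans (cong₂ (λ L L′ → sum (map β L) + sum (map β L′))
               (insertMaxShape⁻¹-++ʳ s₁ 0 (true ∷ b ∷ s₂)) (insertMaxShape⁻¹-++ʳ s₁ 0 (false ∷ b ∷ s₂)))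
        (after-descent b)
  where
  after-descent : ∀ b → sum (map β (map (s₁ ++_) (insertMaxShape⁻¹ 1 (true ∷ b ∷ s₂)))) + 0
                        ≡ sum (map (βJoin s₁) (insertMaxShape⁻¹ 0 (b ∷ s₂)))
  after-descent true  = refl
  after-descent false = cong (λ n → β (s₁ ++ true ∷ s₂) + n + 0) (+-identityʳ (β (s₁ ++ false ∷ s₂)))
βMaxAtJoin-right s₁ s₂ (suc q) _ = begin
  βMaxAtJoin s₁ s₂ (suc (length s₁ + suc q))
    ≡⟨ cong₂ _+_ (right true) (right false) ⟩
  sum (map (β ∘ (s₁ ++_) ∘ (true ∷_)) (insertMaxShape⁻¹ (suc q) s₂))
    + sum (map (β ∘ (s₁ ++_) ∘ (false ∷_)) (insertMaxShape⁻¹ (suc q) s₂))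
    ≡⟨ sum-map-+ (insertMaxShape⁻¹ (suc q) s₂) _ _ ⟨
  sum (map (βJoin s₁) (insertMaxShape⁻¹ (suc q) s₂))
    ∎
  where
  open ≡-Reasoning
  right : ∀ b → βMaxAt (s₁ ++ b ∷ s₂) (suc (length s₁ + suc q))
                  ≡ sum (map (β ∘ (s₁ ++_) ∘ (b ∷_)) (insertMaxShape⁻¹ (suc q) s₂))
  right b = begin
    sum (map β (insertMaxShape⁻¹ (suc (length s₁ + suc q)) (s₁ ++ b ∷ s₂)))
      ≡⟨ cong (sum ∘ map β) (insertMaxShape⁻¹-++ʳ s₁ (suc q) (b ∷ s₂)) ⟩
    sum (map β (map (s₁ ++_) (map (b ∷_) (insertMaxShape⁻¹ (suc q) s₂))))
      ≡⟨ sum-map-∘ (map (b ∷_) (insertMaxShape⁻¹ (suc q) s₂)) β (s₁ ++_) ⟩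
    sum (map (β ∘ (s₁ ++_)) (map (b ∷_) (insertMaxShape⁻¹ (suc q) s₂)))
      ≡⟨ sum-map-∘ (insertMaxShape⁻¹ (suc q) s₂) (β ∘ (s₁ ++_)) (b ∷_) ⟩
    sum (map (β ∘ (s₁ ++_) ∘ (b ∷_)) (insertMaxShape⁻¹ (suc q) s₂))
      ∎

βMaxAtJoin-[]ˡ : ∀ s₂ → βMaxAtJoin [] s₂ 0 ≡ β s₂
βMaxAtJoin-[]ˡ s₂ = +-identityʳ (β s₂)

βMaxAtJoin-[]ʳ : ∀ s₁ → βMaxAtJoin s₁ [] (suc (length s₁ + 0)) ≡ β s₁
βMaxAtJoin-[]ʳ s₁ = begin
  βMaxAtJoin s₁ [] (suc (length s₁ + 0))
    ≡⟨ cong₂ (λ L L′ → sum (map β L) + sum (map β L′))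
             (insertMaxShape⁻¹-++ʳ s₁ 0 (true ∷ [])) (insertMaxShape⁻¹-++ʳ s₁ 0 (false ∷ [])) ⟩
  β (s₁ ++ []) + 0 + 0
    ≡⟨ trans (+-identityʳ _) (+-identityʳ _) ⟩
  β (s₁ ++ [])
    ≡⟨ cong β (++-identityʳ s₁) ⟩
  β s₁
    ∎
  where open ≡-Reasoning

[n+1]C[n+1]≡1 : ∀ n → (n + 1) C suc n ≡ 1
[n+1]C[n+1]≡1 n = trans (cong (_C suc n) (+-comm n 1)) (nCn≡1 (suc n))

βJoin-left-block : ∀ s₁ s₂ → (∀ {t} → length t < length s₁ → ShuffleIdentity t s₂) →
  sumTo (suc (length s₁)) (βMaxAtJoin s₁ s₂) ≡ ((length s₁ + suc (length s₂)) C length s₁) * (β s₁ * β s₂)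
βJoin-left-block []        s₂ _  = trans (βMaxAtJoin-[]ˡ s₂) (sym (trans (*-identityˡ _) (*-identityˡ _)))
βJoin-left-block s₁@(_ ∷ s₁′) s₂ IH = begin
  sumTo (suc (length s₁)) (βMaxAtJoin s₁ s₂)
    ≡⟨ sumTo-cong (suc (length s₁)) (λ p< → trans (βMaxAtJoin-left s₁ s₂ (s≤s z≤n) p<) (sum-map-cong _ (IH′ p<))) ⟩
  sumTo (suc (length s₁)) (λ p → sum (map (λ t → K * (β t * β s₂)) (insertMaxShape⁻¹ p s₁)))
    ≡⟨ sumTo-cong (suc (length s₁)) (λ {p} _ → trans (sum-map-*ˡ (insertMaxShape⁻¹ p s₁) K _)
                                                       (cong (K *_) (sum-map-*ʳ (insertMaxShape⁻¹ p s₁) (β s₂) β))) ⟩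
  sumTo (suc (length s₁)) (λ p → K * (βMaxAt s₁ p * β s₂))
    ≡⟨ trans (sumTo-*ˡ (suc (length s₁)) K _) (cong (K *_) (sumTo-*ʳ (suc (length s₁)) (β s₂) (βMaxAt s₁))) ⟩
  K * (sumTo (suc (length s₁)) (βMaxAt s₁) * β s₂)
    ≡⟨ cong (λ n → K * (n * β s₂)) (β-unfold {s₁} refl) ⟨
  K * (β s₁ * β s₂)
    ∎
  where
  open ≡-Reasoning
  K = (length s₁ + suc (length s₂)) C length s₁
  IH′ : p < suc (length s₁) → t ∈ insertMaxShape⁻¹ p s₁ → βJoin t s₂ ≡ K * (β t * β s₂)
  IH′ {p} {t} (s≤s p≤) t∈ = trans (IH {t} (s≤s (≤-reflexive |t|≡|s₁′|)))
    (cong (λ n → ((suc n + suc (length s₂)) C suc n) * (β t * β s₂)) |t|≡|s₁′|)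
    where |t|≡|s₁′| = suc-injective (length-insertMaxShape⁻¹ p s₁ p≤ t∈)

βJoin-right-block : ∀ s₁ s₂ → (∀ {t} → length t < length s₂ → ShuffleIdentity s₁ t) →
  sumTo (suc (length s₂)) (βMaxAtJoin s₁ s₂ ∘ (suc (length s₁) +_))
    ≡ ((length s₁ + suc (length s₂)) C suc (length s₁)) * (β s₁ * β s₂)
βJoin-right-block s₁ []        _  = begin
  βMaxAtJoin s₁ [] (suc (length s₁ + 0))          ≡⟨ βMaxAtJoin-[]ʳ s₁ ⟩
  β s₁                                            ≡⟨ trans (*-identityˡ _) (*-identityʳ (β s₁)) ⟨
  1 * (β s₁ * 1)                                  ≡⟨ cong (_* (β s₁ * 1)) ([n+1]C[n+1]≡1 (length s₁)) ⟨
  ((length s₁ + 1) C suc (length s₁)) * (β s₁ * 1) ∎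
  where open ≡-Reasoning
βJoin-right-block s₁ s₂@(_ ∷ s₂′) IH = begin
  sumTo (suc (length s₂)) (βMaxAtJoin s₁ s₂ ∘ (suc (length s₁) +_))
    ≡⟨ sumTo-cong (suc (length s₂)) (λ {q} q< → trans (βMaxAtJoin-right s₁ s₂ q (s≤s z≤n)) (sum-map-cong _ (IH′ q<))) ⟩
  sumTo (suc (length s₂)) (λ q → sum (map (λ t → K * (β s₁ * β t)) (insertMaxShape⁻¹ q s₂)))
    ≡⟨ sumTo-cong (suc (length s₂)) (λ {q} _ → trans (sum-map-*ˡ (insertMaxShape⁻¹ q s₂) K _)
                                                       (cong (K *_) (sum-map-*ˡ (insertMaxShape⁻¹ q s₂) (β s₁) β))) ⟩
  sumTo (suc (length s₂)) (λ q → K * (β s₁ * βMaxAt s₂ q))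
    ≡⟨ trans (sumTo-*ˡ (suc (length s₂)) K _) (cong (K *_) (sumTo-*ˡ (suc (length s₂)) (β s₁) (βMaxAt s₂))) ⟩
  K * (β s₁ * sumTo (suc (length s₂)) (βMaxAt s₂))
    ≡⟨ cong (λ n → K * (β s₁ * n)) (β-unfold {s₂} refl) ⟨
  K * (β s₁ * β s₂)
    ∎
  where
  open ≡-Reasoning
  K = (length s₁ + suc (length s₂)) C suc (length s₁)
  IH′ : q < suc (length s₂) → t ∈ insertMaxShape⁻¹ q s₂ → βJoin s₁ t ≡ K * (β s₁ * β t)
  IH′ {q} {t} (s≤s q≤) t∈ = trans (IH {t} (s≤s (≤-reflexive |t|≡|s₂′|)))
    (cong (λ n → (n C suc (length s₁)) * (β s₁ * β t)) (trans (cong (suc (length s₁) +_) (cong suc |t|≡|s₂′|))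
                                                             (sym (+-suc (length s₁) (length s₂)))))
    where |t|≡|s₂′| = suc-injective (length-insertMaxShape⁻¹ q s₂ q≤ t∈)

β-shuffle′ : ∀ fuel s₁ s₂ → length s₁ + length s₂ < fuel → ShuffleIdentity s₁ s₂
β-shuffle′ (suc fuel) s₁ s₂ (s≤s |s₁|+|s₂|≤fuel) = begin
  βJoin s₁ s₂
    ≡⟨ βJoin-unfold s₁ s₂ ⟩
  sumTo (suc a + suc b) G
    ≡⟨ sumTo-split (suc a) (suc b) G ⟩
  sumTo (suc a) G + sumTo (suc b) (G ∘ (suc a +_))
    ≡⟨ cong₂ _+_ (βJoin-left-block s₁ s₂ λ {t} |t|<a → β-shuffle′ fuel t s₂ (<-≤-trans (+-monoˡ-< b |t|<a) |s₁|+|s₂|≤fuel))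
                 (βJoin-right-block s₁ s₂ λ {t} |t|<b → β-shuffle′ fuel s₁ t (<-≤-trans (+-monoʳ-< a |t|<b) |s₁|+|s₂|≤fuel)) ⟩
  ((a + suc b) C a) * β₁β₂ + ((a + suc b) C suc a) * β₁β₂
    ≡⟨ *-distribʳ-+ β₁β₂ ((a + suc b) C a) _ ⟨
  ((a + suc b) C a + (a + suc b) C suc a) * β₁β₂
    ≡⟨ cong (_* β₁β₂) (nCk+nC[k+1]≡[n+1]C[k+1] (a + suc b) a) ⟩
  ((suc a + suc b) C suc a) * β₁β₂
    ∎
  where
  open ≡-Reasoning
  a = length s₁
  b = length s₂
  G = βMaxAtJoin s₁ s₂
  β₁β₂ = β s₁ * β s₂

-- Combinatorially, a permutation of shape s₁ ++ b ∷ s₂ with either letter b amounts to the set of its first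
-- length s₁ + 1 values together with two permutations of shapes s₁ and s₂.
β-shuffle : ∀ s₁ s₂ → ShuffleIdentity s₁ s₂
β-shuffle s₁ s₂ = β-shuffle′ (suc (length s₁ + length s₂)) s₁ s₂ ≤-refl

-- Complement symmetry

sumTo-0 : ∀ n {h : ℕ → ℕ} → (∀ {p} → p < n → h p ≡ 0) → sumTo n h ≡ 0
sumTo-0 zero    _  = refl
sumTo-0 (suc n) h0 = cong₂ _+_ (sumTo-0 n (h0 ∘ m≤n⇒m≤1+n)) (h0 ≤-refl)

insertMaxShape⁻¹-ascents : ∀ p m → p < m → insertMaxShape⁻¹ p (replicate m true) ≡ []
insertMaxShape⁻¹-ascents zero          (suc m)       _         = refl
insertMaxShape⁻¹-ascents (suc zero)    (suc (suc m)) _         = refl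
insertMaxShape⁻¹-ascents (suc zero)    (suc zero)    (s≤s ())
insertMaxShape⁻¹-ascents (suc (suc p)) (suc m)       (s≤s p<m) = cong (map (true ∷_)) (insertMaxShape⁻¹-ascents (suc p) m p<m)

insertMaxShape⁻¹-ascents-last : ∀ m → insertMaxShape⁻¹ (suc m) (replicate (suc m) true) ≡ replicate m true ∷ []
insertMaxShape⁻¹-ascents-last zero    = refl
insertMaxShape⁻¹-ascents-last (suc m) = cong (map (true ∷_)) (insertMaxShape⁻¹-ascents-last m)

insertMaxShape⁻¹-descents : ∀ p m → p < m → insertMaxShape⁻¹ (suc p) (replicate m false) ≡ []
insertMaxShape⁻¹-descents zero     (suc m) _         = refl
insertMaxShape⁻¹-descents (suc p)  (suc m) (s≤s p<m) = cong (map (false ∷_)) (insertMaxShape⁻¹-descents p m p<m)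

β-ascents : ∀ m → β (replicate m true) ≡ 1
β-ascents zero    = refl
β-ascents (suc m) = begin
  β (replicate (suc m) true)
    ≡⟨ β-unfold (length-replicate (suc m)) ⟩
  sumTo (suc m) (βMaxAt (replicate (suc m) true)) + βMaxAt (replicate (suc m) true) (suc m)
    ≡⟨ cong₂ _+_ (sumTo-0 (suc m) λ {p} p< → cong (sum ∘ map β) (insertMaxShape⁻¹-ascents p (suc m) p<))
                 (cong (sum ∘ map β) (insertMaxShape⁻¹-ascents-last m)) ⟩
  β (replicate m true) + 0
    ≡⟨ trans (+-identityʳ _) (β-ascents m) ⟩
  1 ∎
  where open ≡-Reasoning

β-descents : ∀ m → β (replicate m false) ≡ 1
β-descents zero    = refl
β-descents (suc m) = begin
  β (replicate (suc m) false)
    ≡⟨ β-unfold (length-replicate (suc m)) ⟩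
  sumTo (1 + suc m) (βMaxAt (replicate (suc m) false))
    ≡⟨ sumTo-split 1 (suc m) _ ⟩
  β (replicate m false) + 0 + sumTo (suc m) (βMaxAt (replicate (suc m) false) ∘ suc)
    ≡⟨ cong₂ _+_ (trans (+-identityʳ _) (β-descents m))
                 (sumTo-0 (suc m) λ {p} p< → cong (sum ∘ map β) (insertMaxShape⁻¹-descents p (suc m) p<)) ⟩
  1 ∎
  where open ≡-Reasoning

descents : List Bool → ℕ
descents []          = 0
descents (true ∷ s)  = descents s
descents (false ∷ s) = suc (descents s)

descents-++ : ∀ s₁ b s₂ → descents (s₁ ++ b ∷ s₂) ≡ descents s₁ + descents (b ∷ s₂)
descents-++ []          b s₂ = refl
descents-++ (true ∷ s₁) b s₂ = descents-++ s₁ b s₂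
descents-++ (false ∷ s₁) b s₂ = cong suc (descents-++ s₁ b s₂)

ascents⊎descent : ∀ s → s ≡ replicate (length s) true ⊎ ∃ λ s₁ → ∃ λ s₂ → s ≡ s₁ ++ false ∷ s₂
ascents⊎descent []          = inj₁ refl
ascents⊎descent (false ∷ s) = inj₂ ([] , s , refl)
ascents⊎descent (true ∷ s) with ascents⊎descent s
... | inj₁ eq              = inj₁ (cong (true ∷_) eq)
... | inj₂ (s₁ , s₂ , eq) = inj₂ (true ∷ s₁ , s₂ , cong (true ∷_) eq)

-- Complementing the shuffle identity for s₁, s₂ exchanges its two left-hand terms.
β-map-not-descent : ∀ s₁ s₂ → β (map not s₁) ≡ β s₁ → β (map not s₂) ≡ β s₂ →
  β (map not (s₁ ++ true ∷ s₂)) ≡ β (s₁ ++ true ∷ s₂) → β (map not (s₁ ++ false ∷ s₂)) ≡ β (s₁ ++ false ∷ s₂)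
β-map-not-descent s₁ s₂ eq₁ eq₂ eq-ascent = +-cancelˡ-≡ (β (s₁ ++ true ∷ s₂)) _ _ (begin
  β (s₁ ++ true ∷ s₂) + β (map not (s₁ ++ false ∷ s₂))
    ≡⟨ cong (_+ β (map not (s₁ ++ false ∷ s₂))) eq-ascent ⟨
  β (map not (s₁ ++ true ∷ s₂)) + β (map not (s₁ ++ false ∷ s₂))
    ≡⟨ cong₂ (λ x y → β x + β y) (map-++ not s₁ (true ∷ s₂)) (map-++ not s₁ (false ∷ s₂)) ⟩
  β (s₁′ ++ false ∷ s₂′) + β (s₁′ ++ true ∷ s₂′)
    ≡⟨ +-comm (β (s₁′ ++ false ∷ s₂′)) _ ⟩
  βJoin s₁′ s₂′
    ≡⟨ β-shuffle s₁′ s₂′ ⟩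
  ((suc (length s₁′) + suc (length s₂′)) C suc (length s₁′)) * (β s₁′ * β s₂′)
    ≡⟨ cong₂ (λ m n → ((suc m + suc n) C suc m) * (β s₁′ * β s₂′)) (length-map not s₁) (length-map not s₂) ⟩
  ((suc (length s₁) + suc (length s₂)) C suc (length s₁)) * (β s₁′ * β s₂′)
    ≡⟨ cong₂ (λ x y → ((suc (length s₁) + suc (length s₂)) C suc (length s₁)) * (x * y)) eq₁ eq₂ ⟩
  ((suc (length s₁) + suc (length s₂)) C suc (length s₁)) * (β s₁ * β s₂)
    ≡⟨ β-shuffle s₁ s₂ ⟨
  βJoin s₁ s₂ ∎)
  where
  open ≡-Reasoning
  s₁′ = map not s₁
  s₂′ = map not s₂
β-map-not′ : ∀ d s → descents s < d → β (map not s) ≡ β s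
β-map-not′ (suc d) s _ with ascents⊎descent s
... | inj₁ eq = begin
  β (map not s)                             ≡⟨ cong (β ∘ map not) eq ⟩
  β (map not (replicate (length s) true))   ≡⟨ cong β (map-replicate not (length s) true) ⟩
  β (replicate (length s) false)            ≡⟨ trans (β-descents (length s)) (sym (β-ascents (length s))) ⟩
  β (replicate (length s) true)             ≡⟨ cong β eq ⟨
  β s                                       ∎
  where open ≡-Reasoning
β-map-not′ (suc d) s (s≤s descents≤d) | inj₂ (s₁ , s₂ , refl) =
  β-map-not-descent s₁ s₂ (β-map-not′ d s₁ descents₁<d) (β-map-not′ d s₂ descents₂<d)
    (β-map-not′ d (s₁ ++ true ∷ s₂) descents-ascent<d)
  where
  split : descents s₁ + suc (descents s₂) ≤ d
  split = subst (_≤ d) (descents-++ s₁ false s₂) descents≤d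
  descents₁<d : descents s₁ < d
  descents₁<d = <-≤-trans (m<m+n (descents s₁) (s≤s z≤n)) split
  descents₂<d : descents s₂ < d
  descents₂<d = <-≤-trans (m≤n+m (suc (descents s₂)) (descents s₁)) split
  descents-ascent<d : descents (s₁ ++ true ∷ s₂) < d
  descents-ascent<d = subst (_< d) (sym (descents-++ s₁ true s₂)) (<-≤-trans (+-monoʳ-< (descents s₁) (n<1+n _)) split)

β-map-not : ∀ s → β (map not s) ≡ β s
β-map-not s = β-map-not′ (suc (descents s)) s ≤-refl

-- Alternating shapes and the Euler numbers

alternating : Bool → ℕ → List Bool
alternating b zero    = []
alternating b (suc k) = b ∷ alternating (not b) k

length-alternating : ∀ b k → length (alternating b k) ≡ k
length-alternating b zero    = refl
length-alternating b (suc k) = cong suc (length-alternating (not b) k)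

alternating-+ : ∀ b j r → alternating b (j + r) ≡ alternating b j ++ alternating (iterate not b j) r
alternating-+ b zero    r = refl
alternating-+ b (suc j) r = cong (b ∷_) (alternating-+ (not b) j r)

map-not-alternating : ∀ b k → map not (alternating b k) ≡ alternating (not b) k
map-not-alternating b zero    = refl
map-not-alternating b (suc k) = cong (not b ∷_) (map-not-alternating (not b) k)

iterate-not-not : ∀ j b → iterate not (not b) j ≡ not (iterate not b j)
iterate-not-not zero    b = refl
iterate-not-not (suc j) b = iterate-not-not j (not b)

-- Indexed by the length n of the permutations, one more than the length of their shape.
βAlt : Bool → ℕ → ℕ
βAlt b zero    = 1
βAlt b (suc k) = β (alternating b k)

βAlt-not : ∀ b k → βAlt (not b) k ≡ βAlt b k
βAlt-not b zero    = refl
βAlt-not b (suc k) = trans (cong β (sym (map-not-alternating b k))) (β-map-not (alternating b k))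

-- A new maximum can only be inserted at a peak, between an ascent and a descent.
βMaxAt-peak : ∀ u b r → sum (map β (map (u ++_) (insertMaxShape⁻¹ 1 (alternating b (suc r)))))
  ≡ (if b then ((length u + suc r) C suc (length u)) * (β u * βAlt true r) else 0)
βMaxAt-peak u false r        = refl
βMaxAt-peak u true  zero     = begin
  β (u ++ []) + 0                            ≡⟨ trans (+-identityʳ _) (cong β (++-identityʳ u)) ⟩
  β u                                        ≡⟨ trans (*-identityˡ _) (*-identityʳ (β u)) ⟨
  1 * (β u * 1)                              ≡⟨ cong (_* (β u * 1)) ([n+1]C[n+1]≡1 (length u)) ⟨
  ((length u + 1) C suc (length u)) * (β u * 1) ∎
  where open ≡-Reasoning
βMaxAt-peak u true  (suc r)  = begin
  β (u ++ true ∷ w) + (β (u ++ false ∷ w) + 0)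
    ≡⟨ cong (β (u ++ true ∷ w) +_) (+-identityʳ _) ⟩
  βJoin u w
    ≡⟨ β-shuffle u w ⟩
  ((suc (length u) + suc (length w)) C suc (length u)) * (β u * β w)
    ≡⟨ cong (λ n → (n C suc (length u)) * (β u * β w))
            (trans (cong (λ n → suc (length u) + suc n) (length-alternating true r)) (sym (+-suc (length u) (suc r)))) ⟩
  ((length u + suc (suc r)) C suc (length u)) * (β u * β w)
    ∎
  where
  open ≡-Reasoning
  w = alternating true r

βMaxAt-alternating : ∀ b j r → j + suc r ≡ n → βMaxAt (alternating b n) (suc j)
  ≡ (if iterate not b j then (n C suc j) * (βAlt b (suc j) * βAlt true r) else 0)
βMaxAt-alternating b j r refl = begin
  βMaxAt (alternating b (j + suc r)) (suc j)
    ≡⟨ cong₂ βMaxAt (alternating-+ b j (suc r)) (cong suc (sym (trans (+-identityʳ _) (length-alternating b j)))) ⟩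
  βMaxAt (u ++ alternating (iterate not b j) (suc r)) (suc (length u + 0))
    ≡⟨ cong (sum ∘ map β) (insertMaxShape⁻¹-++ʳ u 0 _) ⟩
  sum (map β (map (u ++_) (insertMaxShape⁻¹ 1 (alternating (iterate not b j) (suc r)))))
    ≡⟨ βMaxAt-peak u (iterate not b j) r ⟩
  (if iterate not b j then ((length u + suc r) C suc (length u)) * (β u * βAlt true r) else 0)
    ≡⟨ cong (λ n → if iterate not b j then ((n + suc r) C suc n) * (β u * βAlt true r) else 0) (length-alternating b j) ⟩
  (if iterate not b j then ((j + suc r) C suc j) * (βAlt b (suc j) * βAlt true r) else 0)
    ∎
  where
  open ≡-Reasoning
  u = alternating b j

β-alternating-unfold : ∀ b m → β (alternating b (suc m)) ≡
  (if b then 0 else βAlt true (suc m))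
    + sumTo (suc m) (λ j → if iterate not b j then (suc m C suc j) * (βAlt b (suc j) * βAlt true (m ∸ j)) else 0)
β-alternating-unfold b m = begin
  β (alternating b (suc m))
    ≡⟨ β-unfold (length-alternating b (suc m)) ⟩
  sumTo (1 + suc m) (βMaxAt (alternating b (suc m)))
    ≡⟨ sumTo-split 1 (suc m) _ ⟩
  βMaxAt (alternating b (suc m)) 0 + sumTo (suc m) (βMaxAt (alternating b (suc m)) ∘ suc)
    ≡⟨ cong₂ _+_ (at-start b) (sumTo-cong (suc m) λ {j} j<1+m → βMaxAt-alternating b j (m ∸ j) (j+[1+m∸j] j<1+m)) ⟩
  (if b then 0 else βAlt true (suc m))
    + sumTo (suc m) (λ j → if iterate not b j then (suc m C suc j) * (βAlt b (suc j) * βAlt true (m ∸ j)) else 0)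
    ∎
  where
  open ≡-Reasoning
  at-start : ∀ b → βMaxAt (alternating b (suc m)) 0 ≡ (if b then 0 else βAlt true (suc m))
  at-start true  = refl
  at-start false = +-identityʳ _
  j+[1+m∸j] : ∀ {j} → j < suc m → j + suc (m ∸ j) ≡ suc m
  j+[1+m∸j] {j} (s≤s j≤m) = trans (+-suc j (m ∸ j)) (cong suc (m+[n∸m]≡n j≤m))

sumTo-partition : ∀ n (c : ℕ → Bool) (h : ℕ → ℕ) →
  sumTo n (λ j → if c j then h j else 0) + sumTo n (λ j → if not (c j) then h j else 0) ≡ sumTo n h
sumTo-partition n c h = trans (sym (sumTo-+ n _ _)) (sumTo-cong n λ {j} _ → either-branch (c j) (h j))
  where
  either-branch : ∀ b x → (if b then x else 0) + (if not b then x else 0) ≡ x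
  either-branch true  x = +-identityʳ x
  either-branch false x = refl

-- The maximum of an alternating permutation splits it into two alternating ones.
βAlt-recurrence : ∀ m → βAlt true (suc (suc m)) * 2 ≡
  βAlt true (suc m) + sumTo (suc m) (λ j → (suc m C suc j) * (βAlt true (suc j) * βAlt true (m ∸ j)))
βAlt-recurrence m = begin
  β up * 2
    ≡⟨ trans (*-comm (β up) 2) (cong (β up +_) (+-identityʳ (β up))) ⟩
  β up + β up
    ≡⟨ cong (β up +_) (βAlt-not true (suc (suc m))) ⟨
  β up + β (alternating false (suc m))
    ≡⟨ cong₂ _+_ (β-alternating-unfold true m) (β-alternating-unfold false m) ⟩
  sumTo (suc m) (λ j → if peak j then term j else 0) + (βAlt true (suc m) + sumTo (suc m) (λ j →
    if iterate not false j then (suc m C suc j) * (βAlt false (suc j) * βAlt true (m ∸ j)) else 0))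
    ≡⟨ cong (λ x → sumTo (suc m) (λ j → if peak j then term j else 0) + (βAlt true (suc m) + x))
            (sumTo-cong (suc m) λ {j} _ → cong₂ (λ c x → if c then (suc m C suc j) * (x * βAlt true (m ∸ j)) else 0)
                                                 (iterate-not-not j true) (βAlt-not true (suc j))) ⟩
  sumTo (suc m) (λ j → if peak j then term j else 0) + (βAlt true (suc m) + sumTo (suc m) (λ j → if not (peak j) then term j else 0))
    ≡⟨ +-left-commute (sumTo (suc m) _) (βAlt true (suc m)) _ ⟩
  βAlt true (suc m) + (sumTo (suc m) (λ j → if peak j then term j else 0) + sumTo (suc m) (λ j → if not (peak j) then term j else 0))
    ≡⟨ cong (βAlt true (suc m) +_) (sumTo-partition (suc m) peak term) ⟩
  βAlt true (suc m) + sumTo (suc m) term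
    ∎
  where
  open ≡-Reasoning
  up = alternating true (suc m)
  peak : ℕ → Bool
  peak = iterate not true
  term : ℕ → ℕ
  term j = (suc m C suc j) * (βAlt true (suc j) * βAlt true (m ∸ j))

at-++ˡ : ∀ xs ys {i} → i < length xs → at (xs ++ ys) i ≡ at xs i
at-++ˡ (x ∷ xs) ys {zero}  _         = refl
at-++ˡ (x ∷ xs) ys {suc i} (s≤s i<n) = at-++ˡ xs ys i<n

at-++-length : ∀ xs y → at (xs ++ y ∷ []) (length xs) ≡ y
at-++-length []       y = refl
at-++-length (x ∷ xs) y = at-++-length xs y

length-eulerList : ∀ m → length (eulerList m) ≡ suc m
length-eulerList zero    = refl
length-eulerList (suc m) = trans (length-++ (eulerList m)) (trans (+-comm _ 1) (cong suc (length-eulerList m)))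

eulerList-at : ∀ m → k ≤ m → at (eulerList m) k ≡ E k
eulerList-at {zero}  zero    _   = refl
eulerList-at {k}     (suc m) k≤ with m≤n⇒m<n∨m≡n k≤
... | inj₁ k<1+m = trans (at-++ˡ (eulerList m) _ (subst (k <_) (sym (length-eulerList m)) k<1+m)) (eulerList-at m (≤-pred k<1+m))
... | inj₂ refl  = refl

E-unfold : ∀ m → E (suc (suc m)) ≡ sumTo (suc (suc m)) (λ k → (suc m C k) * E k * E (suc m ∸ k)) / 2
E-unfold m = begin
  E (suc (suc m))
    ≡⟨ trans (cong (at (eulerList (suc m) ++ _ ∷ [])) (sym (length-eulerList (suc m)))) (at-++-length (eulerList (suc m)) _) ⟩
  sum (map h (upTo (suc (suc m)))) / 2
    ≡⟨ cong (_/ 2) (sum-map-upTo (suc (suc m)) h) ⟩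
  sumTo (suc (suc m)) h / 2
    ≡⟨ cong (_/ 2) (sumTo-cong (suc (suc m)) λ {k} k<2+m →
         cong₂ (λ x y → (suc m C k) * x * y) (eulerList-at (suc m) (≤-pred k<2+m)) (eulerList-at (suc m) (m∸n≤m (suc m) k))) ⟩
  sumTo (suc (suc m)) (λ k → (suc m C k) * E k * E (suc m ∸ k)) / 2
    ∎
  where
  open ≡-Reasoning
  h : ℕ → ℕ
  h k = (suc m C k) * at (eulerList (suc m)) k * at (eulerList (suc m)) (suc m ∸ k)

βAlt≡E-step : ∀ m → (∀ {k} → k ≤ m → βAlt true k ≡ E k) → βAlt true (suc m) ≡ E (suc m)
βAlt≡E-step zero    _  = refl
βAlt≡E-step (suc m) IH = sym (begin
  E (suc (suc m))
    ≡⟨ E-unfold m ⟩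
  sumTo (1 + suc m) h / 2
    ≡⟨ cong (_/ 2) (sumTo-split 1 (suc m) h) ⟩
  (h 0 + sumTo (suc m) (h ∘ suc)) / 2
    ≡⟨ cong (_/ 2) (cong₂ _+_ first (sumTo-cong (suc m) rest)) ⟩
  (βAlt true (suc m) + sumTo (suc m) (λ j → (suc m C suc j) * (βAlt true (suc j) * βAlt true (m ∸ j)))) / 2
    ≡⟨ cong (_/ 2) (βAlt-recurrence m) ⟨
  βAlt true (suc (suc m)) * 2 / 2
    ≡⟨ m*n/n≡m (βAlt true (suc (suc m))) 2 ⟩
  βAlt true (suc (suc m))
    ∎)
  where
  open ≡-Reasoning
  h : ℕ → ℕ
  h k = (suc m C k) * E k * E (suc m ∸ k)
  first : h 0 ≡ βAlt true (suc m)
  first = trans (+-identityʳ (E (suc m))) (sym (IH ≤-refl))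
  rest : ∀ {j} → j < suc m → h (suc j) ≡ (suc m C suc j) * (βAlt true (suc j) * βAlt true (m ∸ j))
  rest {j} j<1+m = trans (*-assoc (suc m C suc j) _ _)
    (cong ((suc m C suc j) *_) (sym (cong₂ _*_ (IH j<1+m) (IH (≤-trans (m∸n≤m m j) (n≤1+n m))))))

βAlt≡E : ∀ n → βAlt true n ≡ E n
βAlt≡E n = for-all-≤ n ≤-refl
  where
  for-all-≤ : ∀ m → k ≤ m → βAlt true k ≡ E k
  for-all-≤ zero    z≤n = refl
  for-all-≤ (suc m) k≤ with m≤n⇒m<n∨m≡n k≤
  ... | inj₁ k<1+m = for-all-≤ m (≤-pred k<1+m)
  ... | inj₂ refl  = βAlt≡E-step m (for-all-≤ m)

-- Prefix patterns

Step : Bool → ℕ → ℕ → Set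
Step true  x y = x < y
Step false x y = y < x

Zigzag : Bool → List ℕ → Set
Zigzag b (x ∷ y ∷ σ) = Step b x y × Zigzag (not b) (y ∷ σ)
Zigzag b _           = ⊤

Zigzag⇒shape : ∀ b σ → Zigzag b σ → shape σ ≡ alternating b (length σ ∸ 1)
Zigzag⇒shape b      []          _          = refl
Zigzag⇒shape b      (x ∷ [])    _          = refl
Zigzag⇒shape true  (x ∷ y ∷ σ) (x<y , z) = cong₂ _∷_ (<ᵇ-true x<y) (Zigzag⇒shape false (y ∷ σ) z)
Zigzag⇒shape false (x ∷ y ∷ σ) (y<x , z) = cong₂ _∷_ (<ᵇ-false y<x) (Zigzag⇒shape true (y ∷ σ) z)

shape⇒Zigzag : ∀ b σ → Unique σ → shape σ ≡ alternating b (length σ ∸ 1) → Zigzag b σ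
shape⇒Zigzag b [] _ _ = tt
shape⇒Zigzag b (x ∷ []) _ _ = tt
shape⇒Zigzag b (x ∷ y ∷ σ) ((x≢y ∷ _) ∷ !σ) eq =
  step b (∷-injectiveˡ eq) , shape⇒Zigzag (not b) (y ∷ σ) !σ (∷-injectiveʳ eq)
  where
  step : ∀ b → (x <ᵇ y) ≡ b → Step b x y
  step true  x<ᵇy = <ᵇ-true⁻¹ x<ᵇy
  step false x≮ᵇy = ≤∧≢⇒< (≮⇒≥ (λ x<y → subst T x≮ᵇy (<⇒<ᵇ x<y))) (x≢y ∘ sym)

Step-at⇔Zigzag : ∀ b σ → (∀ i → suc i < length σ → Step (iterate not b i) (at σ i) (at σ (suc i))) ⇔ Zigzag b σ
Step-at⇔Zigzag b σ = mk⇔ (steps b σ) (at-steps b σ)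
  where
  at-steps : ∀ b σ → Zigzag b σ → ∀ i → suc i < length σ → Step (iterate not b i) (at σ i) (at σ (suc i))
  at-steps b (x ∷ y ∷ σ) (xy , z) zero    _          = xy
  at-steps b (x ∷ y ∷ σ) (xy , z) (suc i) (s≤s i<n) = at-steps (not b) (y ∷ σ) z i i<n
  at-steps b (x ∷ [])    _        i       (s≤s ())
  steps : ∀ b σ → (∀ i → suc i < length σ → Step (iterate not b i) (at σ i) (at σ (suc i))) → Zigzag b σ
  steps b []          _     = tt
  steps b (x ∷ [])    _     = tt
  steps b (x ∷ y ∷ σ) step = step 0 (s≤s (s≤s z≤n)) , steps (not b) (y ∷ σ) λ i i<n → step (suc i) (s≤s i<n)

even⊎odd : ∀ i → (Even i × iterate not true i ≡ true) ⊎ ((Even i → ⊥) × iterate not true i ≡ false)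
even⊎odd zero          = inj₁ (ev0 , refl)
even⊎odd (suc zero)    = inj₂ ((λ ()) , refl)
even⊎odd (suc (suc i)) with even⊎odd i
... | inj₁ (even , eq) = inj₁ (ev2 even , eq)
... | inj₂ (odd , eq)  = inj₂ ((λ { (ev2 even) → odd even }) , eq)

parity⇔Step : ∀ i {x y} → ((Even i → x < y) × ((Even i → ⊥) → y < x)) ⇔ Step (iterate not true i) x y
parity⇔Step i with even⊎odd i
... | inj₁ (even , eq) rewrite eq = mk⇔ (λ (up , _) → up even) (λ x<y → (λ _ → x<y) , λ odd → ⊥-elim (odd even))
... | inj₂ (odd , eq)  rewrite eq = mk⇔ (λ (_ , down) → down odd) (λ y<x → (λ even → ⊥-elim (odd even)) , λ _ → y<x)

Alternating⇔Zigzag : Alternating σ ⇔ Zigzag true σ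
Alternating⇔Zigzag {σ} = Step-at⇔Zigzag true σ ⇔-∘
  mk⇔ (λ alt i i<n → to (parity⇔Step i) (alt i i<n)) (λ steps i i<n → from (parity⇔Step i) (steps i i<n))

record Increasing (k : ℕ) (σ : List ℕ) : Set where
  constructor increasing
  field ascent : ∀ i → suc i < k → at σ i < at σ (suc i)

Increasing⇒< : Increasing k σ → i < j → j < k → at σ i < at σ j
Increasing⇒< {j = suc j} inc i<1+j 1+j<k with m≤n⇒m<n∨m≡n (≤-pred i<1+j)
... | inj₁ i<j  = <-trans (Increasing⇒< inc i<j (<-trans (n<1+n j) 1+j<k)) (Increasing.ascent inc j 1+j<k)
... | inj₂ refl = Increasing.ascent inc _ 1+j<k

Increasing⇒<⇔< : Increasing k σ → i < k → j < k → (at σ i < at σ j ⇔ i < j)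
Increasing⇒<⇔< {i = i} {j = j} inc i<k j<k = mk⇔ reflect (λ i<j → Increasing⇒< inc i<j j<k)
  where
  reflect : _ → i < j
  reflect σi<σj with <-cmp i j
  ... | tri< i<j _ _ = i<j
  ... | tri≈ _ refl _ = ⊥-elim (<-irrefl refl σi<σj)
  ... | tri> _ _ j<i = ⊥-elim (<-asym σi<σj (Increasing⇒< inc j<i i<k))

OrderIso4-Increasing : ∀ σ → Increasing 4 P → OrderIso4 σ P ⇔ Increasing 4 σ
OrderIso4-Increasing σ incP = mk⇔
  (λ oi → increasing λ i 1+i<4 → from (oi i (suc i) (<-trans (n<1+n i) 1+i<4) 1+i<4) (Increasing.ascent incP i 1+i<4))
  (λ incσ i j i<4 j<4 → mk⇔ (from (Increasing⇒<⇔< incP i<4 j<4) ∘ to (Increasing⇒<⇔< incσ i<4 j<4))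
                             (from (Increasing⇒<⇔< incσ i<4 j<4) ∘ to (Increasing⇒<⇔< incP i<4 j<4)))

Increasing-4⇔ : ∀ {x₀ x₁ x₂ x₃ ρ} → Increasing 4 (x₀ ∷ x₁ ∷ x₂ ∷ x₃ ∷ ρ) ⇔ (x₀ < x₁ × x₁ < x₂ × x₂ < x₃)
Increasing-4⇔ = mk⇔
  (λ (increasing inc) → inc 0 (s<s z<s) , inc 1 (s<s (s<s z<s)) , inc 2 (s<s (s<s (s<s z<s))))
  (λ ascents → increasing (steps ascents))
  where
  steps : ∀ {x₀ x₁ x₂ x₃ ρ} → x₀ < x₁ × x₁ < x₂ × x₂ < x₃ →
    ∀ i → suc i < 4 → at (x₀ ∷ x₁ ∷ x₂ ∷ x₃ ∷ ρ) i < at (x₀ ∷ x₁ ∷ x₂ ∷ x₃ ∷ ρ) (suc i)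
  steps (x₀<x₁ , _ , _)     zero                _ = x₀<x₁
  steps (_ , x₁<x₂ , _)     (suc zero)          _ = x₁<x₂
  steps (_ , _ , x₂<x₃)     (suc (suc zero))    _ = x₂<x₃
  steps _ (suc (suc (suc i))) (s<s (s<s (s<s (s<s ()))))

OrderIso4-rearrange : (f : List ℕ → List ℕ) (π : ℕ → ℕ) → (∀ {i} → i < 4 → π i < 4) → ∀ σ P →
  (∀ i → at (f σ) i ≡ at σ (π i)) → (∀ i → at (f P) i ≡ at P (π i)) → OrderIso4 σ P → OrderIso4 (f σ) (f P)
OrderIso4-rearrange f π π<4 σ P fσ≡ fP≡ oi i j i<4 j<4
  rewrite fσ≡ i | fσ≡ j | fP≡ i | fP≡ j = oi (π i) (π j) (π<4 i<4) (π<4 j<4)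

-- Positions are 0-based as in at: swap₁₂ exchanges σ₂ and σ₃, and rotate turns σ₁σ₂σ₃ into σ₂σ₃σ₁.
swap₁₂ : List ℕ → List ℕ
swap₁₂ (x ∷ y ∷ z ∷ σ) = x ∷ z ∷ y ∷ σ
swap₁₂ σ               = σ

swap₁₂-index : ℕ → ℕ
swap₁₂-index 1 = 2
swap₁₂-index 2 = 1
swap₁₂-index i = i

rotate : List ℕ → List ℕ
rotate (x ∷ y ∷ z ∷ σ) = y ∷ z ∷ x ∷ σ
rotate σ               = σ

rotate-index : ℕ → ℕ
rotate-index 0 = 1
rotate-index 1 = 2
rotate-index 2 = 0
rotate-index i = i

rotate⁻¹ : List ℕ → List ℕ
rotate⁻¹ (x ∷ y ∷ z ∷ σ) = z ∷ x ∷ y ∷ σ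
rotate⁻¹ σ               = σ

rotate⁻¹-index : ℕ → ℕ
rotate⁻¹-index 0 = 2
rotate⁻¹-index 1 = 0
rotate⁻¹-index 2 = 1
rotate⁻¹-index i = i

swap₁₂-involutive : ∀ σ → swap₁₂ (swap₁₂ σ) ≡ σ
swap₁₂-involutive []              = refl
swap₁₂-involutive (x ∷ [])        = refl
swap₁₂-involutive (x ∷ y ∷ [])    = refl
swap₁₂-involutive (x ∷ y ∷ z ∷ σ) = refl

rotate-rotate⁻¹ : ∀ σ → rotate (rotate⁻¹ σ) ≡ σ
rotate-rotate⁻¹ []              = refl
rotate-rotate⁻¹ (x ∷ [])        = refl
rotate-rotate⁻¹ (x ∷ y ∷ [])    = refl
rotate-rotate⁻¹ (x ∷ y ∷ z ∷ σ) = refl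

rotate⁻¹-rotate : ∀ σ → rotate⁻¹ (rotate σ) ≡ σ
rotate⁻¹-rotate []              = refl
rotate⁻¹-rotate (x ∷ [])        = refl
rotate⁻¹-rotate (x ∷ y ∷ [])    = refl
rotate⁻¹-rotate (x ∷ y ∷ z ∷ σ) = refl

at-swap₁₂ : ∀ x y z σ i → at (swap₁₂ (x ∷ y ∷ z ∷ σ)) i ≡ at (x ∷ y ∷ z ∷ σ) (swap₁₂-index i)
at-swap₁₂ _ _ _ _ 0                   = refl
at-swap₁₂ _ _ _ _ 1                   = refl
at-swap₁₂ _ _ _ _ 2                   = refl
at-swap₁₂ _ _ _ _ (suc (suc (suc i))) = refl

at-rotate : ∀ x y z σ i → at (rotate (x ∷ y ∷ z ∷ σ)) i ≡ at (x ∷ y ∷ z ∷ σ) (rotate-index i)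
at-rotate _ _ _ _ 0                   = refl
at-rotate _ _ _ _ 1                   = refl
at-rotate _ _ _ _ 2                   = refl
at-rotate _ _ _ _ (suc (suc (suc i))) = refl

at-rotate⁻¹ : ∀ x y z σ i → at (rotate⁻¹ (x ∷ y ∷ z ∷ σ)) i ≡ at (x ∷ y ∷ z ∷ σ) (rotate⁻¹-index i)
at-rotate⁻¹ _ _ _ _ 0                   = refl
at-rotate⁻¹ _ _ _ _ 1                   = refl
at-rotate⁻¹ _ _ _ _ 2                   = refl
at-rotate⁻¹ _ _ _ _ (suc (suc (suc i))) = refl

swap₁₂-index-<4 : i < 4 → swap₁₂-index i < 4
swap₁₂-index-<4 {0} i<4 = i<4
swap₁₂-index-<4 {1} _   = s<s (s<s z<s)
swap₁₂-index-<4 {2} _   = s<s z<s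
swap₁₂-index-<4 {suc (suc (suc _))} i<4 = i<4

rotate-index-<4 : i < 4 → rotate-index i < 4
rotate-index-<4 {0} _   = s<s z<s
rotate-index-<4 {1} _   = s<s (s<s z<s)
rotate-index-<4 {2} _   = z<s
rotate-index-<4 {suc (suc (suc _))} i<4 = i<4

rotate⁻¹-index-<4 : i < 4 → rotate⁻¹-index i < 4
rotate⁻¹-index-<4 {0} _   = s<s (s<s z<s)
rotate⁻¹-index-<4 {1} _   = z<s
rotate⁻¹-index-<4 {2} _   = s<s z<s
rotate⁻¹-index-<4 {suc (suc (suc _))} i<4 = i<4

increasingThenAlternating : ℕ → List Bool
increasingThenAlternating r = true ∷ true ∷ true ∷ alternating false r

data FourOrMore : List ℕ → Set where
  four : ∀ x₀ x₁ x₂ x₃ ρ → FourOrMore (x₀ ∷ x₁ ∷ x₂ ∷ x₃ ∷ ρ)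

IsPerm⇒FourOrMore : IsPerm (4 + r) σ → FourOrMore σ
IsPerm⇒FourOrMore {r} {σ} σ↭ = fourOrMore σ (subst (4 ≤_) (sym (IsPerm⇒length σ↭)) (m≤m+n 4 r))
  where
  fourOrMore : ∀ σ → 4 ≤ length σ → FourOrMore σ
  fourOrMore (x₀ ∷ x₁ ∷ x₂ ∷ x₃ ∷ ρ) _ = four x₀ x₁ x₂ x₃ ρ
  fourOrMore (_ ∷ [])         (s≤s ())
  fourOrMore (_ ∷ _ ∷ [])     (s≤s (s≤s ()))
  fourOrMore (_ ∷ _ ∷ _ ∷ []) (s≤s (s≤s (s≤s ())))

Perms-increasingThenAlternating⇔ : ∀ {x₀ x₁ x₂ x₃ ρ} →
  Perms (4 + r) (increasingThenAlternating r) (x₀ ∷ x₁ ∷ x₂ ∷ x₃ ∷ ρ)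
    ⇔ (IsPerm (4 + r) (x₀ ∷ x₁ ∷ x₂ ∷ x₃ ∷ ρ) × Increasing 4 (x₀ ∷ x₁ ∷ x₂ ∷ x₃ ∷ ρ) × Zigzag false (x₃ ∷ ρ))
Perms-increasingThenAlternating⇔ {r} {x₀} {x₁} {x₂} {x₃} {ρ} = mk⇔
  (λ (σ↭ , eq) → σ↭ , from Increasing-4⇔ (ascents eq) , shape⇒Zigzag false (x₃ ∷ ρ) (tail-unique σ↭) (tail-shape σ↭ eq))
  (λ (σ↭ , inc , z) → σ↭ , shape-eq σ↭ (to Increasing-4⇔ inc) z)
  where
  |ρ|≡r : IsPerm (4 + r) (x₀ ∷ x₁ ∷ x₂ ∷ x₃ ∷ ρ) → length ρ ≡ r
  |ρ|≡r σ↭ = +-cancelˡ-≡ 4 _ _ (IsPerm⇒length σ↭)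
  tail-unique : IsPerm (4 + r) (x₀ ∷ x₁ ∷ x₂ ∷ x₃ ∷ ρ) → Unique (x₃ ∷ ρ)
  tail-unique σ↭ with _ ∷ _ ∷ _ ∷ !x₃ρ ← IsPerm⇒Unique σ↭ = !x₃ρ
  ascents : shape (x₀ ∷ x₁ ∷ x₂ ∷ x₃ ∷ ρ) ≡ increasingThenAlternating r → x₀ < x₁ × x₁ < x₂ × x₂ < x₃
  ascents eq = <ᵇ-true⁻¹ (∷-injectiveˡ eq) , <ᵇ-true⁻¹ (∷-injectiveˡ (∷-injectiveʳ eq)) ,
               <ᵇ-true⁻¹ (∷-injectiveˡ (∷-injectiveʳ (∷-injectiveʳ eq)))
  tail-shape : IsPerm (4 + r) (x₀ ∷ x₁ ∷ x₂ ∷ x₃ ∷ ρ) → shape (x₀ ∷ x₁ ∷ x₂ ∷ x₃ ∷ ρ) ≡ increasingThenAlternating r →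
    shape (x₃ ∷ ρ) ≡ alternating false (length ρ)
  tail-shape σ↭ eq = trans (∷-injectiveʳ (∷-injectiveʳ (∷-injectiveʳ eq))) (cong (alternating false) (sym (|ρ|≡r σ↭)))
  shape-eq : IsPerm (4 + r) (x₀ ∷ x₁ ∷ x₂ ∷ x₃ ∷ ρ) → x₀ < x₁ × x₁ < x₂ × x₂ < x₃ → Zigzag false (x₃ ∷ ρ) →
    shape (x₀ ∷ x₁ ∷ x₂ ∷ x₃ ∷ ρ) ≡ increasingThenAlternating r
  shape-eq σ↭ (x₀<x₁ , x₁<x₂ , x₂<x₃) z =
    cong₂ _∷_ (<ᵇ-true x₀<x₁) (cong₂ _∷_ (<ᵇ-true x₁<x₂) (cong₂ _∷_ (<ᵇ-true x₂<x₃)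
      (trans (Zigzag⇒shape false (x₃ ∷ ρ) z) (cong (alternating false) (|ρ|≡r σ↭)))))

-- For an alternating pattern P the order condition already forces the first three steps of τ to alternate.
InAP⇔ : ∀ {p₀ p₁ p₂ p₃ y₀ y₁ y₂ y₃ ρ} → Zigzag true (p₀ ∷ p₁ ∷ p₂ ∷ p₃ ∷ []) →
  InAP (p₀ ∷ p₁ ∷ p₂ ∷ p₃ ∷ []) n (y₀ ∷ y₁ ∷ y₂ ∷ y₃ ∷ ρ)
    ⇔ (IsPerm n (y₀ ∷ y₁ ∷ y₂ ∷ y₃ ∷ ρ) × OrderIso4 (y₀ ∷ y₁ ∷ y₂ ∷ y₃ ∷ ρ) (p₀ ∷ p₁ ∷ p₂ ∷ p₃ ∷ [])
       × Zigzag false (y₃ ∷ ρ))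
InAP⇔ (p₀<p₁ , p₂<p₁ , p₂<p₃ , _) = mk⇔
  (λ ((τ↭ , alt) , oi) → τ↭ , oi , proj₂ (proj₂ (proj₂ (to Alternating⇔Zigzag alt))))
  (λ (τ↭ , oi , z) → (τ↭ , from Alternating⇔Zigzag
      (from (oi 0 1 z<s (s<s z<s)) p₀<p₁ , from (oi 2 1 (s<s (s<s z<s)) (s<s z<s)) p₂<p₁ ,
       from (oi 2 3 (s<s (s<s z<s)) (s<s (s<s (s<s z<s)))) p₂<p₃ , z)) , oi)

Perms-increasingThenAlternating-count : ∀ r → HasCard (Perms (4 + r) (increasingThenAlternating r)) (β (increasingThenAlternating r))
Perms-increasingThenAlternating-count r =
  subst (λ n → HasCard (Perms (4 + n) (increasingThenAlternating r)) (β (increasingThenAlternating r)))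
    (length-alternating false r) (Perms-count (increasingThenAlternating r))

ordered1234 : Increasing 4 (1 ∷ 2 ∷ 3 ∷ 4 ∷ [])
ordered1234 = from Increasing-4⇔ (s<s z<s , s<s (s<s z<s) , s<s (s<s (s<s z<s)))

A¹³²⁴-count : ∀ r → HasCard (InAP (1 ∷ 3 ∷ 2 ∷ 4 ∷ []) (4 + r)) (β (increasingThenAlternating r))
A¹³²⁴-count r = HasCard-bijection into back (λ {τ} _ → swap₁₂-involutive τ) (λ {σ} _ → swap₁₂-involutive σ)
  (Perms-increasingThenAlternating-count r)
  where
  zigzag1324 : Zigzag true (1 ∷ 3 ∷ 2 ∷ 4 ∷ [])
  zigzag1324 = s<s z<s , s<s (s<s z<s) , s<s (s<s z<s) , tt
  into : Perms (4 + r) (increasingThenAlternating r) σ → InAP (1 ∷ 3 ∷ 2 ∷ 4 ∷ []) (4 + r) (swap₁₂ σ)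
  into Pσ with four x₀ x₁ x₂ x₃ ρ ← IsPerm⇒FourOrMore (proj₁ Pσ)
    with σ↭ , inc , z ← to Perms-increasingThenAlternating⇔ Pσ
    = from (InAP⇔ zigzag1324) (↭-trans (prep x₀ (swap x₂ x₁ ↭-refl)) σ↭ ,
        OrderIso4-rearrange swap₁₂ swap₁₂-index swap₁₂-index-<4 (x₀ ∷ x₁ ∷ x₂ ∷ x₃ ∷ ρ) (1 ∷ 2 ∷ 3 ∷ 4 ∷ [])
          (at-swap₁₂ x₀ x₁ x₂ (x₃ ∷ ρ)) (at-swap₁₂ 1 2 3 (4 ∷ []))
          (from (OrderIso4-Increasing _ ordered1234) inc) , z)
  back : InAP (1 ∷ 3 ∷ 2 ∷ 4 ∷ []) (4 + r) τ → Perms (4 + r) (increasingThenAlternating r) (swap₁₂ τ)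
  back Aτ with four y₀ y₁ y₂ y₃ ρ ← IsPerm⇒FourOrMore (proj₁ (proj₁ Aτ))
    with τ↭ , oi , z ← to (InAP⇔ zigzag1324) Aτ
    = from Perms-increasingThenAlternating⇔ (↭-trans (prep y₀ (swap y₂ y₁ ↭-refl)) τ↭ ,
        to (OrderIso4-Increasing _ ordered1234)
          (OrderIso4-rearrange swap₁₂ swap₁₂-index swap₁₂-index-<4 (y₀ ∷ y₁ ∷ y₂ ∷ y₃ ∷ ρ) (1 ∷ 3 ∷ 2 ∷ 4 ∷ [])
            (at-swap₁₂ y₀ y₁ y₂ (y₃ ∷ ρ)) (at-swap₁₂ 1 3 2 (4 ∷ [])) oi) , z)

A²³¹⁴-count : ∀ r → HasCard (InAP (2 ∷ 3 ∷ 1 ∷ 4 ∷ []) (4 + r)) (β (increasingThenAlternating r))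
A²³¹⁴-count r = HasCard-bijection into back (λ {τ} _ → rotate-rotate⁻¹ τ) (λ {σ} _ → rotate⁻¹-rotate σ)
  (Perms-increasingThenAlternating-count r)
  where
  zigzag2314 : Zigzag true (2 ∷ 3 ∷ 1 ∷ 4 ∷ [])
  zigzag2314 = s<s (s<s z<s) , s<s z<s , s<s z<s , tt
  into : Perms (4 + r) (increasingThenAlternating r) σ → InAP (2 ∷ 3 ∷ 1 ∷ 4 ∷ []) (4 + r) (rotate σ)
  into Pσ with four x₀ x₁ x₂ x₃ ρ ← IsPerm⇒FourOrMore (proj₁ Pσ)
    with σ↭ , inc , z ← to Perms-increasingThenAlternating⇔ Pσ
    = from (InAP⇔ zigzag2314) (↭-trans (↭-trans (prep x₁ (swap x₂ x₀ ↭-refl)) (swap x₁ x₀ ↭-refl)) σ↭ ,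
        OrderIso4-rearrange rotate rotate-index rotate-index-<4 (x₀ ∷ x₁ ∷ x₂ ∷ x₃ ∷ ρ) (1 ∷ 2 ∷ 3 ∷ 4 ∷ [])
          (at-rotate x₀ x₁ x₂ (x₃ ∷ ρ)) (at-rotate 1 2 3 (4 ∷ []))
          (from (OrderIso4-Increasing _ ordered1234) inc) , z)
  back : InAP (2 ∷ 3 ∷ 1 ∷ 4 ∷ []) (4 + r) τ → Perms (4 + r) (increasingThenAlternating r) (rotate⁻¹ τ)
  back Aτ with four y₀ y₁ y₂ y₃ ρ ← IsPerm⇒FourOrMore (proj₁ (proj₁ Aτ))
    with τ↭ , oi , z ← to (InAP⇔ zigzag2314) Aτ
    = from Perms-increasingThenAlternating⇔ (↭-trans (↭-trans (swap y₂ y₀ ↭-refl) (prep y₀ (swap y₂ y₁ ↭-refl))) τ↭ ,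
        to (OrderIso4-Increasing _ ordered1234)
          (OrderIso4-rearrange rotate⁻¹ rotate⁻¹-index rotate⁻¹-index-<4 (y₀ ∷ y₁ ∷ y₂ ∷ y₃ ∷ ρ) (2 ∷ 3 ∷ 1 ∷ 4 ∷ [])
            (at-rotate⁻¹ y₀ y₁ y₂ (y₃ ∷ ρ)) (at-rotate⁻¹ 2 3 1 (4 ∷ [])) oi) , z)

-- Shuffle identity with s₁ = U and s₂ alternating: the word U U s₂ is increasingThenAlternating, U D s₂ is alternating.
β-increasingThenAlternating : ∀ r → β (increasingThenAlternating r) + E (4 + r) ≡ ((4 + r) C 2) * E (2 + r)
β-increasingThenAlternating r = begin
  β (increasingThenAlternating r) + E (4 + r)
    ≡⟨ cong (β (increasingThenAlternating r) +_) (βAlt≡E (4 + r)) ⟨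
  βJoin (true ∷ []) (alternating true (suc r))
    ≡⟨ β-shuffle (true ∷ []) (alternating true (suc r)) ⟩
  ((2 + suc (length (alternating true (suc r)))) C 2) * (1 * β (alternating true (suc r)))
    ≡⟨ cong₂ (λ n x → ((2 + suc n) C 2) * x) (length-alternating true (suc r)) (*-identityˡ _) ⟩
  ((4 + r) C 2) * βAlt true (2 + r)
    ≡⟨ cong (((4 + r) C 2) *_) (βAlt≡E (2 + r)) ⟩
  ((4 + r) C 2) * E (2 + r)
    ∎
  where open ≡-Reasoning

open import Data.Integer using (+_; _-_; _⊖_)
open import Data.Integer.Properties using ([+m]-[+n]≡m⊖n; ⊖-≥)

+m≡+[m+n]-+n : ∀ m n → + m ≡ + (m + n) - + n
+m≡+[m+n]-+n m n = sym (begin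
  + (m + n) - + n    ≡⟨ [+m]-[+n]≡m⊖n (m + n) n ⟩
  (m + n) ⊖ n        ≡⟨ ⊖-≥ (m≤n+m n m) ⟩
  + (m + n ∸ n)      ≡⟨ cong +_ (m+n∸n≡m m n) ⟩
  + m                ∎)
  where open ≡-Reasoning

mainTheorem9 : (n : ℕ) → 4 ≤ n →
  Σ ℕ (λ a → HasCard (InAP (1 ∷ 3 ∷ 2 ∷ 4 ∷ []) n) a × (+ a ≡ (+ ((n C 2) * E (n ∸ 2)) - + E n)))
    × Σ ℕ (λ b → HasCard (InAP (2 ∷ 3 ∷ 1 ∷ 4 ∷ []) n) b × (+ b ≡ (+ ((n C 2) * E (n ∸ 2)) - + E n)))
mainTheorem9 (suc (suc (suc (suc r)))) (s≤s (s≤s (s≤s (s≤s z≤n)))) =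
  (β (increasingThenAlternating r) , A¹³²⁴-count r , formula) ,
  (β (increasingThenAlternating r) , A²³¹⁴-count r , formula)
  where
  formula : + β (increasingThenAlternating r) ≡ + (((4 + r) C 2) * E (2 + r)) - + E (4 + r)
  formula = trans (+m≡+[m+n]-+n _ (E (4 + r))) (cong (λ m → + m - + E (4 + r)) (β-increasingThenAlternating r))
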